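{- There exists a constant $C>0$ such that for all $n$ the integrity of the hypercube satisfies $$I(Q_n)\le C\frac{2^n}{\sqrt{n}}\sqrt{\log n}.$$
   Context: $Q_n$ is the $n$-dimensional hypercube: vertex set $\{0,1\}^n$, two vertices adjacent iff they differ in exactly one coordinate. For a graph $H$, $m(H)$ denotes the number of vertices in a largest connected component of $H$. The integrity of a graph $G$ is $I(G)=\min\{|S|+m(G\setminus S): S\subseteq V(G)\}$. -}

module Defs where

open import Data.Nat using (ℕ; zero; suc; _+_; _≤_)
open import Data.Bool using (Bool; true; false; if_then_else_)
open import Data.Vec using (Vec; []; _∷_; lookup)
open import Data.Fin using (Fin)
open import Data.List using (List; []; _∷_; map; _++_; length)
open import Data.Nat.ListAction using (sum)
open import Data.List.Relation.Unary.All using (All)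
open import Data.List.Relation.Unary.Unique.Propositional using (Unique)
open import Data.Product using (Σ; ∃; ∃-syntax; _×_; _,_)
open import Relation.Binary.PropositionalEquality using (_≡_; _≢_)

Vertex : ℕ → Set
Vertex n = Vec Bool n

Adj : ∀ {n} → Vertex n → Vertex n → Set
Adj {n} u v = ∃[ i ] (lookup u i ≢ lookup v i × (∀ (j : Fin n) → j ≢ i → lookup u j ≡ lookup v j))

allVertices : (n : ℕ) → List (Vertex n)
allVertices zero = [] ∷ []
allVertices (suc n) = map (true ∷_) (allVertices n) ++ map (false ∷_) (allVertices n)

VSubset : ℕ → Set
VSubset n = Vertex n → Bool

card : ∀ {n} → VSubset n → ℕ
card {n} S = sum (map (λ v → if S v then 1 else 0) (allVertices n))

data Reach {n : ℕ} (S : VSubset n) : Vertex n → Vertex n → Set where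
  here : ∀ {u} → S u ≡ false → Reach S u u
  step : ∀ {u v w} → S u ≡ false → Adj u v → Reach S v w → Reach S u w

SameComponent : ∀ {n} → VSubset n → List (Vertex n) → Set
SameComponent S xs = All (λ u → All (λ w → Reach S u w) xs) xs

CompBound : ∀ {n} → VSubset n → ℕ → Set
CompBound S m = ∀ xs → Unique xs → SameComponent S xs → length xs ≤ m

-- m(Q_n \ S) ≡ m : largest component of Q_n \ S has exactly m vertices
-- (m = 0 when Q_n \ S is empty)
IsMaxComp : ∀ {n} → VSubset n → ℕ → Set
IsMaxComp S m = CompBound S m × (∃[ xs ] (Unique xs × SameComponent S xs × length xs ≡ m))

IsIntegrity : ℕ → ℕ → Set
IsIntegrity n k =
  (∃[ S ] ∃[ m ] (IsMaxComp {n} S m × k ≡ card S + m))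
  × (∀ (S : VSubset n) m → IsMaxComp S m → k ≤ card S + m)

-- Fix a radius R and let b = |B(R)| = Σ_{i≤R} C(n,i) and s = C(n,R) + C(n,R+1), the size of
-- the two spheres bounding a ball. Cover Q_n greedily by balls of radius R, each time choosing
-- a centre whose boundary spheres meet few still uncovered vertices per newly covered one;
-- double counting shows that some centre achieves the average ratio s/b. Label every vertex by
-- the first ball covering it and delete the vertices having a differently labelled neighbour:
-- each of them lies on a boundary sphere met while uncovered, so at most s·2^n/b vertices are
-- deleted, and every remaining component lies inside one ball. Hence I(Q_n)·b ≤ s·2^n + b².
-- For R = n/2 − Θ(√(n log n)) binomial estimates give b ≤ 2^n/√n and s ≲ b·√(log n / n),
-- so I(Q_n)² n ≤ C·4^n log n.

module Submission where

open import Defs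
open import Data.Bool using (Bool; true; false; if_then_else_; _∧_; not; _xor_; T)
import Data.Bool as Bool
open import Data.Bool.ListAction using (any)
open import Data.Bool.Properties using (¬-not; T-≡; T-not-≡)
open import Data.Empty using (⊥-elim)
open import Data.Fin using () renaming (zero to fzero; suc to fsuc)
import Data.Fin.Properties as Fin
open import Data.List using (List; []; _∷_; map; _++_; length)
open import Data.List.Membership.Propositional using (_∈_; find; lose)
open import Data.List.Membership.Propositional.Properties using (∈-++⁺ˡ; ∈-++⁺ʳ; ∈-map⁺; ∈-map⁻)
open import Data.List.Properties using (map-++; map-∘; map-cong; length-++; length-map)
open import Data.List.Relation.Unary.All as All using (All; []; _∷_)
open import Data.List.Relation.Unary.AllPairs using ([]; _∷_)
open import Data.List.Relation.Unary.Any using (here; there; any?)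
open import Data.List.Relation.Unary.Any.Properties using (any⁺; any⁻)
open import Data.List.Relation.Unary.Unique.Propositional using (Unique)
open import Data.Nat
open import Data.Nat.Combinatorics using (_C_; nCk+nC[k+1]≡[n+1]C[k+1]; nC1≡n; k>n⇒nCk≡0)
open import Data.Nat.DivMod using (_/_; _%_; m≡m%n+[m/n]*n; m%n<n; m/n*n≤m; m≥n⇒m/n>0)
open import Data.Nat.Induction using (<-rec)
open import Data.Nat.ListAction using (sum)
open import Data.Nat.ListAction.Properties using (sum-++)
open import Data.Nat.Logarithm using (⌊log₂_⌋; ⌊log₂⌋-mono-≤; ⌊log₂⌊n/2⌋⌋≡⌊log₂n⌋∸1)
open import Data.Nat.Properties
open import Data.Nat.Tactic.RingSolver using (solve-∀)
open import Data.Product using (∃-syntax; _×_; _,_; proj₁; proj₂)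
open import Data.Sum using ([_,_]′)
open import Data.Vec using (Vec; []; _∷_; lookup; replicate)
open import Data.Vec.Properties using (≡-dec; tabulate∘lookup; tabulate-cong)
open import Function using (_∘_; Equivalence)
open import Relation.Binary.PropositionalEquality
open import Relation.Nullary using (¬_; Dec; yes; no; does)
open import Relation.Nullary.Decidable using (_×-dec_; decidable-stable; ¬¬-excluded-middle)
open import Algebra.Properties.CommutativeSemigroup +-commutativeSemigroup
  using () renaming (interchange to +-interchange)
open import Algebra.Properties.CommutativeSemigroup *-commutativeSemigroup
  using (xy∙z≈xz∙y; x∙yz≈xz∙y; x∙yz≈y∙xz) renaming (interchange to *-interchange)

-- Finite sums

private variable
  A B : Set

∑ : List A → (A → ℕ) → ℕ
∑ xs f = sum (map f xs)

∑-++ : ∀ (xs ys : List A) f → ∑ (xs ++ ys) f ≡ ∑ xs f + ∑ ys f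
∑-++ xs ys f = trans (cong sum (map-++ f xs ys)) (sum-++ (map f xs) (map f ys))

∑-map : ∀ (g : A → B) xs f → ∑ (map g xs) f ≡ ∑ xs (f ∘ g)
∑-map g xs f = cong sum (sym (map-∘ xs))

∑-cong : ∀ (xs : List A) {f g} → (∀ x → f x ≡ g x) → ∑ xs f ≡ ∑ xs g
∑-cong xs f≗g = cong sum (map-cong f≗g xs)

∑-distrib-+ : ∀ (xs : List A) f g → ∑ xs (λ x → f x + g x) ≡ ∑ xs f + ∑ xs g
∑-distrib-+ [] f g = refl
∑-distrib-+ (x ∷ xs) f g =
  trans (cong (f x + g x +_) (∑-distrib-+ xs f g)) (+-interchange (f x) (g x) _ _)

∑-*ˡ : ∀ (xs : List A) c f → ∑ xs (λ x → c * f x) ≡ c * ∑ xs f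
∑-*ˡ [] c f = sym (*-zeroʳ c)
∑-*ˡ (x ∷ xs) c f = trans (cong (c * f x +_) (∑-*ˡ xs c f)) (sym (*-distribˡ-+ c (f x) _))

∑-*ʳ : ∀ (xs : List A) c f → ∑ xs (λ x → f x * c) ≡ ∑ xs f * c
∑-*ʳ xs c f = trans (∑-cong xs (λ x → *-comm (f x) c)) (trans (∑-*ˡ xs c f) (*-comm c _))

∑-zero : ∀ (xs : List A) → ∑ xs (λ _ → 0) ≡ 0
∑-zero [] = refl
∑-zero (x ∷ xs) = ∑-zero xs

∑-const : ∀ (xs : List A) c → ∑ xs (λ _ → c) ≡ c * length xs
∑-const [] c = sym (*-zeroʳ c)
∑-const (x ∷ xs) c = trans (cong (c +_) (∑-const xs c)) (sym (*-suc c (length xs)))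

∑-comm : ∀ (xs : List A) (ys : List B) (f : A → B → ℕ) →
         ∑ xs (λ x → ∑ ys (f x)) ≡ ∑ ys (λ y → ∑ xs (λ x → f x y))
∑-comm [] ys f = sym (∑-zero ys)
∑-comm (x ∷ xs) ys f =
  trans (cong (∑ ys (f x) +_) (∑-comm xs ys f))
        (sym (∑-distrib-+ ys (f x) (λ y → ∑ xs (λ x′ → f x′ y))))

∑-mono-≤ : ∀ (xs : List A) {f g} → (∀ {x} → x ∈ xs → f x ≤ g x) → ∑ xs f ≤ ∑ xs g
∑-mono-≤ [] f≤g = z≤n
∑-mono-≤ (x ∷ xs) f≤g = +-mono-≤ (f≤g (here refl)) (∑-mono-≤ xs (f≤g ∘ there))

∑-mono-< : ∀ (xs : List A) {f g y} → y ∈ xs → (∀ {x} → x ∈ xs → f x ≤ g x) →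
           f y < g y → ∑ xs f < ∑ xs g
∑-mono-< (x ∷ xs) (here refl) f≤g fy<gy = +-mono-<-≤ fy<gy (∑-mono-≤ xs (f≤g ∘ there))
∑-mono-< (x ∷ xs) (there y∈xs) f≤g fy<gy =
  +-mono-≤-< (f≤g (here refl)) (∑-mono-< xs y∈xs (f≤g ∘ there) fy<gy)

≤-∑ : ∀ (xs : List A) f {y} → y ∈ xs → f y ≤ ∑ xs f
≤-∑ (x ∷ xs) f (here refl) = m≤m+n (f x) _
≤-∑ (x ∷ xs) f (there y∈xs) = ≤-trans (≤-∑ xs f y∈xs) (m≤n+m _ (f x))

∑-averaging : ∀ (xs : List A) (F G H : A → ℕ) → ∑ xs F ≡ ∑ xs G →
              ∀ {y} → y ∈ xs → 0 < H y → (∀ x → H x ≡ 0 → G x ≡ 0) →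
              ∃[ x ] (x ∈ xs × 0 < H x × F x ≤ G x)
∑-averaging xs F G H ∑F≡∑G {y} y∈xs 0<Hy H≡0⇒G≡0
  with any? (λ x → (0 <? H x) ×-dec (F x ≤? G x)) xs
... | yes found = find found
... | no none = ⊥-elim (<-irrefl (sym ∑F≡∑G) (∑-mono-< xs y∈xs G≤F (≰⇒> (bad y∈xs 0<Hy))))
  where
  bad : ∀ {x} → x ∈ xs → 0 < H x → ¬ F x ≤ G x
  bad x∈xs 0<Hx Fx≤Gx = none (lose x∈xs (0<Hx , Fx≤Gx))
  G≤F : ∀ {x} → x ∈ xs → G x ≤ F x
  G≤F {x} x∈xs with H x in Hx≡
  ... | zero = ≤-trans (≤-reflexive (H≡0⇒G≡0 x Hx≡)) z≤n
  ... | suc _ = <⇒≤ (≰⇒> (bad x∈xs (subst (0 <_) (sym Hx≡) z<s)))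

∑≤ : ℕ → (ℕ → ℕ) → ℕ
∑≤ zero f = f zero
∑≤ (suc R) f = ∑≤ R f + f (suc R)

∑≤-mono : ∀ R {f g} → (∀ i → i ≤ R → f i ≤ g i) → ∑≤ R f ≤ ∑≤ R g
∑≤-mono zero f≤g = f≤g 0 z≤n
∑≤-mono (suc R) f≤g = +-mono-≤ (∑≤-mono R (λ i i≤R → f≤g i (m≤n⇒m≤1+n i≤R))) (f≤g (suc R) ≤-refl)

∑≤-*ˡ : ∀ R c f → ∑≤ R (λ i → c * f i) ≡ c * ∑≤ R f
∑≤-*ˡ zero c f = refl
∑≤-*ˡ (suc R) c f = trans (cong (_+ c * f (suc R)) (∑≤-*ˡ R c f)) (sym (*-distribˡ-+ c (∑≤ R f) (f (suc R))))

∑≤-*ʳ : ∀ R f c → ∑≤ R (λ i → f i * c) ≡ ∑≤ R f * c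
∑≤-*ʳ zero f c = refl
∑≤-*ʳ (suc R) f c = trans (cong (_+ f (suc R) * c) (∑≤-*ʳ R f c)) (sym (*-distribʳ-+ c (∑≤ R f) (f (suc R))))

≤-∑≤ : ∀ f m → f m ≤ ∑≤ m f
≤-∑≤ f zero = ≤-refl
≤-∑≤ f (suc m) = m≤n+m (f (suc m)) (∑≤ m f)

∑≤-shift : ∀ f u R → ∑≤ R (λ i → f (i + u)) ≤ ∑≤ (R + u) f
∑≤-shift f u zero = ≤-∑≤ f u
∑≤-shift f u (suc R) = +-monoˡ-≤ (f (suc R + u)) (∑≤-shift f u R)

t*c≤∑≤ : ∀ t R c g → t ≤ suc R → (∀ j → j < t → c ≤ g (R ∸ j)) → t * c ≤ ∑≤ R g
t*c≤∑≤ zero R c g _ _ = z≤n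
t*c≤∑≤ (suc zero) zero c g _ c≤g = ≤-trans (≤-reflexive (+-identityʳ c)) (c≤g 0 z<s)
t*c≤∑≤ (suc t) (suc R) c g (s≤s t≤1+R) c≤g = ≤-trans (≤-reflexive (+-comm c (t * c)))
  (+-mono-≤ (t*c≤∑≤ t R c g t≤1+R (λ j j<t → c≤g (suc j) (s≤s j<t))) (c≤g 0 z<s))

-- Elementary arithmetic

*-cancelʳ-≤′ : ∀ {x y} c → 0 < c → x * c ≤ y * c → x ≤ y
*-cancelʳ-≤′ {x} {y} (suc c) _ = *-cancelʳ-≤ x y (suc c)

isqrt : ∀ m → ∃[ q ] (q * q ≤ m × m < suc q * suc q)
isqrt zero = 0 , z≤n , z<s
isqrt (suc m) with isqrt m
... | q , q²≤m , m<[1+q]² with suc q * suc q ≤? suc m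
...   | yes [1+q]²≤1+m = suc q , [1+q]²≤1+m , ≤-trans (s≤s m<[1+q]²) (*-mono-< (n<1+n (suc q)) (n<1+n (suc q)))
...   | no [1+q]²≰1+m = q , m≤n⇒m≤1+n q²≤m , ≰⇒> [1+q]²≰1+m

m<[1+m/n]*n : ∀ m n .{{_ : NonZero n}} → m < suc (m / n) * n
m<[1+m/n]*n m n = begin-strict
  m                    ≡⟨ m≡m%n+[m/n]*n m n ⟩
  m % n + (m / n) * n  <⟨ +-monoˡ-< _ (m%n<n m n) ⟩
  n + (m / n) * n      ≡⟨⟩
  suc (m / n) * n      ∎
  where open ≤-Reasoning

⌊n/2⌋-bounds : ∀ n → 2 * ⌊ n /2⌋ ≤ n × n ≤ suc (2 * ⌊ n /2⌋)
⌊n/2⌋-bounds zero = z≤n , z≤n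
⌊n/2⌋-bounds (suc zero) = z≤n , s≤s z≤n
⌊n/2⌋-bounds (suc (suc n)) with ⌊n/2⌋-bounds n
... | lower , upper = ≤-trans (≤-reflexive (double ⌊ n /2⌋)) (s≤s (s≤s lower)) ,
                      ≤-trans (s≤s (s≤s upper)) (≤-reflexive (cong suc (sym (double ⌊ n /2⌋))))
  where
  double : ∀ h → 2 * suc h ≡ suc (suc (2 * h))
  double = solve-∀

log₂-bounds : ∀ n → 0 < n → 2 ^ ⌊log₂ n ⌋ ≤ n × n < 2 * 2 ^ ⌊log₂ n ⌋
log₂-bounds = <-rec _ bounds
  where
  bounds : ∀ n → (∀ {m} → m < n → 0 < m → 2 ^ ⌊log₂ m ⌋ ≤ m × m < 2 * 2 ^ ⌊log₂ m ⌋) →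
           0 < n → 2 ^ ⌊log₂ n ⌋ ≤ n × n < 2 * 2 ^ ⌊log₂ n ⌋
  bounds (suc zero) _ _ = s≤s z≤n , s≤s (s≤s z≤n)
  bounds n@(suc (suc m)) rec _ = subst Bounds 1+[L∸1]≡L (lower , upper)
    where
    h : ℕ
    h = ⌊ n /2⌋
    L : ℕ
    L = ⌊log₂ n ⌋
    Bounds : ℕ → Set
    Bounds k = 2 ^ k ≤ n × n < 2 * 2 ^ k
    1+[L∸1]≡L : suc (L ∸ 1) ≡ L
    1+[L∸1]≡L = trans (+-comm 1 (L ∸ 1)) (m∸n+n≡m (⌊log₂⌋-mono-≤ {2} {n} (s≤s (s≤s z≤n))))
    half : 2 ^ (L ∸ 1) ≤ h × h < 2 * 2 ^ (L ∸ 1)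
    half = subst (λ k → 2 ^ k ≤ h × h < 2 * 2 ^ k) (⌊log₂⌊n/2⌋⌋≡⌊log₂n⌋∸1 n)
                 (rec (⌊n/2⌋<n (suc m)) z<s)
    lower : 2 ^ suc (L ∸ 1) ≤ n
    lower = ≤-trans (*-monoʳ-≤ 2 (proj₁ half)) (proj₁ (⌊n/2⌋-bounds n))
    upper : n < 2 * 2 ^ suc (L ∸ 1)
    upper = ≤-trans (s≤s (proj₂ (⌊n/2⌋-bounds n))) (≤-trans (≤-reflexive (sym (*-suc 2 h))) (*-monoʳ-≤ 2 (proj₂ half)))

c*[L+2]≤2^L : ∀ c L₀ → c * (L₀ + 2) ≤ 2 ^ L₀ → ∀ L → L₀ ≤ L → c * (L + 2) ≤ 2 ^ L
c*[L+2]≤2^L c L₀ base L L₀≤L = subst (λ L → c * (L + 2) ≤ 2 ^ L) (m+[n∸m]≡n L₀≤L) (go (L ∸ L₀))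
  where
  go : ∀ i → c * (L₀ + i + 2) ≤ 2 ^ (L₀ + i)
  go zero = subst (λ L → c * (L + 2) ≤ 2 ^ L) (sym (+-identityʳ L₀)) base
  go (suc i) = begin
    c * (L₀ + suc i + 2)                 ≡⟨ cong (λ x → c * (x + 2)) (+-suc L₀ i) ⟩
    c * suc (L₀ + i + 2)                 ≡⟨ *-suc c (L₀ + i + 2) ⟩
    c + c * (L₀ + i + 2)                 ≤⟨ +-monoˡ-≤ _ (m≤m*n c (L₀ + i + 2) {{L₀+i+2≢0}}) ⟩
    c * (L₀ + i + 2) + c * (L₀ + i + 2)  ≤⟨ +-mono-≤ (go i) (go i) ⟩
    2 ^ (L₀ + i) + 2 ^ (L₀ + i)          ≡⟨ cong (2 ^ (L₀ + i) +_) (+-identityʳ _) ⟨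
    2 ^ suc (L₀ + i)                     ≡⟨ cong (2 ^_) (+-suc L₀ i) ⟨
    2 ^ (L₀ + suc i)                     ∎
    where
    open ≤-Reasoning
    L₀+i+2≢0 : NonZero (L₀ + i + 2)
    L₀+i+2≢0 = subst NonZero (+-comm 2 (L₀ + i)) _

4^n≡2^n*2^n : ∀ n → 4 ^ n ≡ 2 ^ n * 2 ^ n
4^n≡2^n*2^n zero = refl
4^n≡2^n*2^n (suc n) = trans (cong (4 *_) (4^n≡2^n*2^n n)) (regroup (2 ^ n))
  where
  regroup : ∀ x → 4 * (x * x) ≡ (2 * x) * (2 * x)
  regroup = solve-∀

2xy≤x²+y² : ∀ x y → 2 * (x * y) ≤ x * x + y * y
2xy≤x²+y² x y = [ ordered , (λ y≤x → subst₂ _≤_ (cong (2 *_) (*-comm y x)) (+-comm (y * y) (x * x)) (ordered y≤x)) ]′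
                  (≤-total x y)
  where
  expand : ∀ x z → 2 * (x * (x + z)) + z * z ≡ x * x + (x + z) * (x + z)
  expand = solve-∀
  ordered : ∀ {x y} → x ≤ y → 2 * (x * y) ≤ x * x + y * y
  ordered {x} {y} x≤y = subst (λ y → 2 * (x * y) ≤ x * x + y * y) (m+[n∸m]≡n x≤y)
    (≤-trans (m≤m+n _ ((y ∸ x) * (y ∸ x))) (≤-reflexive (expand x (y ∸ x))))

[x+y]²≤2x²+2y² : ∀ x y → (x + y) * (x + y) ≤ 2 * (x * x) + 2 * (y * y)
[x+y]²≤2x²+2y² x y = begin
  (x + y) * (x + y)                ≡⟨ expand x y ⟩
  x * x + y * y + 2 * (x * y)      ≤⟨ +-monoʳ-≤ (x * x + y * y) (2xy≤x²+y² x y) ⟩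
  x * x + y * y + (x * x + y * y)  ≡⟨ collect x y ⟩
  2 * (x * x) + 2 * (y * y)        ∎
  where
  open ≤-Reasoning
  expand : ∀ x y → (x + y) * (x + y) ≡ x * x + y * y + 2 * (x * y)
  expand = solve-∀
  collect : ∀ x y → x * x + y * y + (x * x + y * y) ≡ 2 * (x * x) + 2 * (y * y)
  collect = solve-∀

m*m≤n*n⇒m≤n : ∀ {m n} → m * m ≤ n * n → m ≤ n
m*m≤n*n⇒m≤n {m} {n} m²≤n² with m ≤? n
... | yes m≤n = m≤n
... | no m≰n = ⊥-elim (<⇒≱ (*-mono-< (≰⇒> m≰n) (≰⇒> m≰n)) m²≤n²)

bernoulli-upper : ∀ a e j → (a + e) ^ suc j ≤ (a + e) * a ^ j + j * e * (a + e) ^ j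
bernoulli-upper a e zero = ≤-reflexive (sym (+-identityʳ _))
bernoulli-upper a e (suc j) = begin
  d * d ^ suc j                                   ≤⟨ *-monoʳ-≤ d (bernoulli-upper a e j) ⟩
  d * (d * aʲ + j * e * dʲ)                       ≡⟨ expand a e j aʲ dʲ ⟩
  d * (a * aʲ) + e * (d * aʲ) + j * e * (d * dʲ)  ≤⟨ +-monoˡ-≤ (j * e * (d * dʲ)) (+-monoʳ-≤ (d * (a * aʲ)) (*-monoʳ-≤ e (*-monoʳ-≤ d aʲ≤dʲ))) ⟩
  d * (a * aʲ) + e * (d * dʲ) + j * e * (d * dʲ)  ≡⟨ collect a e j aʲ dʲ ⟩
  d * (a * aʲ) + suc j * e * (d * dʲ)             ∎
  where
  open ≤-Reasoning
  d : ℕ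
  d = a + e
  aʲ : ℕ
  aʲ = a ^ j
  dʲ : ℕ
  dʲ = d ^ j
  aʲ≤dʲ : aʲ ≤ dʲ
  aʲ≤dʲ = ^-monoˡ-≤ j (m≤m+n a e)
  expand : ∀ a e j A D → (a + e) * ((a + e) * A + j * e * D) ≡
           (a + e) * (a * A) + e * ((a + e) * A) + j * e * ((a + e) * D)
  expand = solve-∀
  collect : ∀ a e j A D → (a + e) * (a * A) + e * ((a + e) * D) + j * e * ((a + e) * D) ≡
            (a + e) * (a * A) + (1 + j) * e * ((a + e) * D)
  collect = solve-∀

[a+e]^j≤2*a^j : ∀ a e j → 0 < a + e → 2 * j * e ≤ a + e → (a + e) ^ j ≤ 2 * a ^ j
[a+e]^j≤2*a^j a e j 0<d 2je≤d = *-cancelʳ-≤′ d 0<d (+-cancelʳ-≤ (D * d) (D * d) (2 * a ^ j * d) (begin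
  D * d + D * d                  ≡⟨ double d D ⟩
  2 * (d * D)                    ≤⟨ *-monoʳ-≤ 2 (bernoulli-upper a e j) ⟩
  2 * (d * a ^ j + j * e * D)    ≡⟨ distribute d (a ^ j) j e D ⟩
  2 * a ^ j * d + 2 * j * e * D  ≤⟨ +-monoʳ-≤ (2 * a ^ j * d) (*-monoˡ-≤ D 2je≤d) ⟩
  2 * a ^ j * d + d * D          ≡⟨ cong (2 * a ^ j * d +_) (*-comm d D) ⟩
  2 * a ^ j * d + D * d          ∎))
  where
  open ≤-Reasoning
  d : ℕ
  d = a + e
  D : ℕ
  D = d ^ j
  double : ∀ d D → D * d + D * d ≡ 2 * (d * D)
  double = solve-∀
  distribute : ∀ d A j e D → 2 * (d * A + j * e * D) ≡ 2 * A * d + 2 * j * e * D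
  distribute = solve-∀

bernoulli : ∀ a e j → a ^ j * (a + j * e) ≤ (a + e) ^ j * a
bernoulli a e zero = ≤-reflexive (cong (λ m → 1 * m) (+-identityʳ a))
bernoulli a e (suc j) = begin
  a * aʲ * (a + suc j * e)                         ≡⟨ expand a e j aʲ ⟩
  a * (aʲ * (a + j * e)) + e * (aʲ * a)            ≤⟨ +-monoʳ-≤ (a * (aʲ * (a + j * e))) (*-monoʳ-≤ e (*-monoʳ-≤ aʲ (m≤m+n a (j * e)))) ⟩
  a * (aʲ * (a + j * e)) + e * (aʲ * (a + j * e))  ≡⟨ *-distribʳ-+ (aʲ * (a + j * e)) a e ⟨
  (a + e) * (aʲ * (a + j * e))                     ≤⟨ *-monoʳ-≤ (a + e) (bernoulli a e j) ⟩
  (a + e) * ((a + e) ^ j * a)                      ≡⟨ *-assoc (a + e) ((a + e) ^ j) a ⟨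
  (a + e) ^ suc j * a                              ∎
  where
  open ≤-Reasoning
  aʲ : ℕ
  aʲ = a ^ j
  expand : ∀ a e j A → a * A * (a + (1 + j) * e) ≡ a * (A * (a + j * e)) + e * (A * a)
  expand = solve-∀

2*N^w≤[N+g]^w : ∀ N g w → 0 < N → N ≤ w * g → 2 * N ^ w ≤ (N + g) ^ w
2*N^w≤[N+g]^w N g w 0<N N≤wg = *-cancelʳ-≤′ N 0<N (begin
  2 * N ^ w * N        ≡⟨ double (N ^ w) N ⟩
  N ^ w * (N + N)      ≤⟨ *-monoʳ-≤ (N ^ w) (+-monoʳ-≤ N N≤wg) ⟩
  N ^ w * (N + w * g)  ≤⟨ bernoulli N g w ⟩
  (N + g) ^ w * N      ∎)
  where
  open ≤-Reasoning
  double : ∀ A N → 2 * A * N ≡ A * (N + N)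
  double = solve-∀

2^j*Y^j≤X^j : ∀ X Y j → 2 * Y ≤ X → 2 ^ j * Y ^ j ≤ X ^ j
2^j*Y^j≤X^j X Y zero _ = ≤-refl
2^j*Y^j≤X^j X Y (suc j) 2Y≤X = begin
  2 * 2 ^ j * (Y * Y ^ j)    ≡⟨ *-interchange 2 (2 ^ j) Y (Y ^ j) ⟩
  (2 * Y) * (2 ^ j * Y ^ j)  ≤⟨ *-mono-≤ 2Y≤X (2^j*Y^j≤X^j X Y j 2Y≤X) ⟩
  X * X ^ j                  ∎
  where open ≤-Reasoning

-- The hypercube

-- card S from Defs is definitionally ∑ (allVertices n) (λ v → ⟦ S v ⟧).
⟦_⟧ : Bool → ℕ
⟦ b ⟧ = if b then 1 else 0

⟦∧⟧ : ∀ a b → ⟦ a ∧ b ⟧ ≡ ⟦ a ⟧ * ⟦ b ⟧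
⟦∧⟧ true true = refl
⟦∧⟧ true false = refl
⟦∧⟧ false b = refl

⟦⟧≤1 : ∀ a → ⟦ a ⟧ ≤ 1
⟦⟧≤1 true = s≤s z≤n
⟦⟧≤1 false = z≤n

⟦⟧-split : ∀ a b → ⟦ a ⟧ ≡ ⟦ a ∧ b ⟧ + ⟦ a ∧ not b ⟧
⟦⟧-split true true = refl
⟦⟧-split true false = refl
⟦⟧-split false b = refl

⟦≤ᵇ0⟧ : ∀ d → ⟦ d ≤ᵇ 0 ⟧ ≡ ⟦ d ≡ᵇ 0 ⟧
⟦≤ᵇ0⟧ zero = refl
⟦≤ᵇ0⟧ (suc d) = refl

⟦≤ᵇsuc⟧ : ∀ d R → ⟦ d ≤ᵇ suc R ⟧ ≡ ⟦ d ≤ᵇ R ⟧ + ⟦ d ≡ᵇ suc R ⟧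
⟦≤ᵇsuc⟧ zero R = refl
⟦≤ᵇsuc⟧ (suc zero) zero = refl
⟦≤ᵇsuc⟧ (suc (suc d)) zero = refl
⟦≤ᵇsuc⟧ (suc zero) (suc R) = refl
⟦≤ᵇsuc⟧ (suc (suc d)) (suc R) = ⟦≤ᵇsuc⟧ (suc d) R

≤ᵇ≡true⇒≤ : ∀ {m n} → (m ≤ᵇ n) ≡ true → m ≤ n
≤ᵇ≡true⇒≤ {m} {n} e = ≤ᵇ⇒≤ m n (Equivalence.from T-≡ e)

≤ᵇ≡false⇒> : ∀ {m n} → (m ≤ᵇ n) ≡ false → n < m
≤ᵇ≡false⇒> {m} {n} e = ≰⇒> (λ m≤n → subst T e (≤⇒≤ᵇ m≤n))

≡⇒≡ᵇ≡true : ∀ {m n} → m ≡ n → (m ≡ᵇ n) ≡ true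
≡⇒≡ᵇ≡true {m} {n} e = Equivalence.to T-≡ (≡⇒≡ᵇ m n e)

≡ᵇ≡true⇒≡ : ∀ {m n} → (m ≡ᵇ n) ≡ true → m ≡ n
≡ᵇ≡true⇒≡ {m} {n} e = ≡ᵇ⇒≡ m n (Equivalence.from T-≡ e)

∑⟦⟧≤length : ∀ (xs : List A) (p : A → Bool) → ∑ xs (λ x → ⟦ p x ⟧) ≤ length xs
∑⟦⟧≤length [] p = z≤n
∑⟦⟧≤length (x ∷ xs) p = +-mono-≤ (⟦⟧≤1 (p x)) (∑⟦⟧≤length xs p)

dist : ∀ {n} → Vertex n → Vertex n → ℕ
dist [] [] = 0
dist (a ∷ x) (b ∷ y) = ⟦ a xor b ⟧ + dist x y

dist-comm : ∀ {n} (x y : Vertex n) → dist x y ≡ dist y x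
dist-comm [] [] = refl
dist-comm (a ∷ x) (b ∷ y) = cong₂ _+_ (cong ⟦_⟧ (xor-comm a b)) (dist-comm x y)
  where
  xor-comm : ∀ a b → a xor b ≡ b xor a
  xor-comm true true = refl
  xor-comm true false = refl
  xor-comm false true = refl
  xor-comm false false = refl

dist-self : ∀ {n} (x : Vertex n) → dist x x ≡ 0
dist-self [] = refl
dist-self (true ∷ x) = dist-self x
dist-self (false ∷ x) = dist-self x

∈-allVertices : ∀ n (v : Vertex n) → v ∈ allVertices n
∈-allVertices zero [] = here refl
∈-allVertices (suc n) (true ∷ v) = ∈-++⁺ˡ (∈-map⁺ (true ∷_) (∈-allVertices n v))
∈-allVertices (suc n) (false ∷ v) = ∈-++⁺ʳ _ (∈-map⁺ (false ∷_) (∈-allVertices n v))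

length-allVertices : ∀ n → length (allVertices n) ≡ 2 ^ n
length-allVertices zero = refl
length-allVertices (suc n) = begin
  length (map (true ∷_) V ++ map (false ∷_) V)          ≡⟨ length-++ (map (true ∷_) V) ⟩
  length (map (true ∷_) V) + length (map (false ∷_) V)  ≡⟨ cong₂ _+_ (length-map _ V) (length-map _ V) ⟩
  length V + length V                                   ≡⟨ cong (λ m → m + m) (length-allVertices n) ⟩
  2 ^ n + 2 ^ n                                         ≡⟨ cong (2 ^ n +_) (sym (+-identityʳ (2 ^ n))) ⟩
  2 ^ suc n                                             ∎
  where
  open ≡-Reasoning
  V : List (Vertex n)
  V = allVertices n

∑-allVertices-suc : ∀ n (f : Vertex (suc n) → ℕ) →
  ∑ (allVertices (suc n)) f ≡ ∑ (allVertices n) (λ v → f (true ∷ v)) + ∑ (allVertices n) (λ v → f (false ∷ v))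
∑-allVertices-suc n f = trans (∑-++ (map (true ∷_) V) _ f) (cong₂ _+_ (∑-map _ V f) (∑-map _ V f))
  where
  V : List (Vertex n)
  V = allVertices n

sphere-size : ∀ n (x : Vertex n) k → ∑ (allVertices n) (λ c → ⟦ dist x c ≡ᵇ k ⟧) ≡ n C k
sphere-size zero [] zero = refl
sphere-size zero [] (suc k) = refl
sphere-size (suc n) (true ∷ x) zero =
  trans (∑-allVertices-suc n _) (cong₂ _+_ (sphere-size n x 0) (∑-zero (allVertices n)))
sphere-size (suc n) (false ∷ x) zero =
  trans (∑-allVertices-suc n _) (cong₂ _+_ (∑-zero (allVertices n)) (sphere-size n x 0))
sphere-size (suc n) (true ∷ x) (suc k) = begin
  _                  ≡⟨ ∑-allVertices-suc n _ ⟩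
  _                  ≡⟨ cong₂ _+_ (sphere-size n x (suc k)) (sphere-size n x k) ⟩
  n C suc k + n C k  ≡⟨ +-comm (n C suc k) (n C k) ⟩
  n C k + n C suc k  ≡⟨ nCk+nC[k+1]≡[n+1]C[k+1] n k ⟩
  suc n C suc k      ∎
  where open ≡-Reasoning
sphere-size (suc n) (false ∷ x) (suc k) = begin
  _                  ≡⟨ ∑-allVertices-suc n _ ⟩
  _                  ≡⟨ cong₂ _+_ (sphere-size n x k) (sphere-size n x (suc k)) ⟩
  n C k + n C suc k  ≡⟨ nCk+nC[k+1]≡[n+1]C[k+1] n k ⟩
  suc n C suc k      ∎
  where open ≡-Reasoning

ball : ℕ → ℕ → ℕ
ball n R = ∑≤ R (n C_)

ball-size : ∀ n (x : Vertex n) R → ∑ (allVertices n) (λ c → ⟦ dist x c ≤ᵇ R ⟧) ≡ ball n R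
ball-size n x zero = trans (∑-cong V (λ c → ⟦≤ᵇ0⟧ (dist x c))) (sphere-size n x 0)
  where
  V : List (Vertex n)
  V = allVertices n
ball-size n x (suc R) = begin
  ∑ V (λ c → ⟦ dist x c ≤ᵇ suc R ⟧)                                  ≡⟨ ∑-cong V (λ c → ⟦≤ᵇsuc⟧ (dist x c) R) ⟩
  ∑ V (λ c → ⟦ dist x c ≤ᵇ R ⟧ + ⟦ dist x c ≡ᵇ suc R ⟧)              ≡⟨ ∑-distrib-+ V _ _ ⟩
  ∑ V (λ c → ⟦ dist x c ≤ᵇ R ⟧) + ∑ V (λ c → ⟦ dist x c ≡ᵇ suc R ⟧)  ≡⟨ cong₂ _+_ (ball-size n x R) (sphere-size n x (suc R)) ⟩
  ball n (suc R)                                                     ∎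
  where
  open ≡-Reasoning
  V : List (Vertex n)
  V = allVertices n

ball≤2^n : ∀ n R → ball n R ≤ 2 ^ n
ball≤2^n n R = begin
  ball n R                                     ≡⟨ ball-size n x R ⟨
  ∑ (allVertices n) (λ c → ⟦ dist x c ≤ᵇ R ⟧)  ≤⟨ ∑⟦⟧≤length (allVertices n) _ ⟩
  length (allVertices n)                       ≡⟨ length-allVertices n ⟩
  2 ^ n                                        ∎
  where
  open ≤-Reasoning
  x : Vertex n
  x = replicate n true

0<ball : ∀ n R → 0 < ball n R
0<ball n zero = z<s
0<ball n (suc R) = ≤-trans (0<ball n R) (m≤m+n _ _)

neighbours : ∀ {n} → Vertex n → List (Vertex n)
neighbours [] = []
neighbours (a ∷ x) = (not a ∷ x) ∷ map (a ∷_) (neighbours x)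

dist-neighbour : ∀ {n} {x y : Vertex n} (c : Vertex n) → y ∈ neighbours x →
                 dist y c ≤ suc (dist x c) × dist x c ≤ suc (dist y c)
dist-neighbour {x = a ∷ x} (b ∷ c) (here refl) =
  +-monoˡ-≤ (dist x c) (proj₁ (flip-xor a b)) , +-monoˡ-≤ (dist x c) (proj₂ (flip-xor a b))
  where
  flip-xor : ∀ a b → ⟦ not a xor b ⟧ ≤ suc ⟦ a xor b ⟧ × ⟦ a xor b ⟧ ≤ suc ⟦ not a xor b ⟧
  flip-xor true true = s≤s z≤n , z≤n
  flip-xor true false = z≤n , s≤s z≤n
  flip-xor false true = z≤n , s≤s z≤n
  flip-xor false false = s≤s z≤n , z≤n
dist-neighbour {x = a ∷ x} (b ∷ c) (there y∈) with ∈-map⁻ (a ∷_) y∈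
... | y , y∈′ , refl with dist-neighbour c y∈′
... | ≤₁ , ≤₂ = ≤-trans (+-monoʳ-≤ ⟦ a xor b ⟧ ≤₁) (≤-reflexive (+-suc _ _)) ,
                ≤-trans (+-monoʳ-≤ ⟦ a xor b ⟧ ≤₂) (≤-reflexive (+-suc _ _))

lookup-ext : ∀ {n} (x y : Vec A n) → (∀ j → lookup x j ≡ lookup y j) → x ≡ y
lookup-ext x y eq = trans (sym (tabulate∘lookup x)) (trans (tabulate-cong eq) (tabulate∘lookup y))

Adj⇒∈neighbours : ∀ {n} {u v : Vertex n} → Adj u v → v ∈ neighbours u
Adj⇒∈neighbours {u = a ∷ u} {b ∷ v} (fzero , a≢b , rest≡)
  rewrite ¬-not (a≢b ∘ sym) | lookup-ext v u (λ j → sym (rest≡ (fsuc j) (λ ()))) = here refl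
Adj⇒∈neighbours {u = a ∷ u} {b ∷ v} (fsuc i , ≢ᵢ , rest≡) with rest≡ fzero (λ ())
... | refl = there (∈-map⁺ (a ∷_) (Adj⇒∈neighbours (i , ≢ᵢ , λ j j≢i → rest≡ (fsuc j) (j≢i ∘ Fin.suc-injective))))

-- Greedy covers by Hamming balls

module BallCover (n R : ℕ) where

  V : List (Vertex n)
  V = allVertices n

  inBall : Vertex n → VSubset n
  inBall c x = dist x c ≤ᵇ R

  shell : Vertex n → Vertex n → ℕ
  shell c x = ⟦ dist x c ≡ᵇ R ⟧ + ⟦ dist x c ≡ᵇ suc R ⟧

  vol : ℕ
  vol = ball n R

  shellVol : ℕ
  shellVol = n C R + n C suc R

  inner-shell : ∀ c x → dist x c ≡ R → 0 < shell c x
  inner-shell c x d≡R = <-≤-trans (subst (λ b → 0 < ⟦ b ⟧) (sym (≡⇒≡ᵇ≡true d≡R)) z<s) (m≤m+n _ _)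

  outer-shell : ∀ c x → dist x c ≡ suc R → 0 < shell c x
  outer-shell c x d≡1+R = <-≤-trans (subst (λ b → 0 < ⟦ b ⟧) (sym (≡⇒≡ᵇ≡true d≡1+R)) z<s) (m≤n+m _ _)

  _∖ball_ : VSubset n → Vertex n → VSubset n
  (U ∖ball c) x = U x ∧ not (inBall c x)

  gain : VSubset n → Vertex n → ℕ
  gain U c = ∑ V (λ x → ⟦ U x ∧ inBall c x ⟧)

  cost : VSubset n → Vertex n → ℕ
  cost U c = ∑ V (λ x → ⟦ U x ⟧ * shell c x)

  ∑-gain : ∀ U → ∑ V (gain U) ≡ card U * vol
  ∑-gain U = begin
    ∑ V (gain U)                                      ≡⟨ ∑-comm V V (λ c x → ⟦ U x ∧ inBall c x ⟧) ⟩
    ∑ V (λ x → ∑ V (λ c → ⟦ U x ∧ inBall c x ⟧))      ≡⟨ ∑-cong V (λ x → ∑-cong V (λ c → ⟦∧⟧ (U x) (inBall c x))) ⟩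
    ∑ V (λ x → ∑ V (λ c → ⟦ U x ⟧ * ⟦ inBall c x ⟧))  ≡⟨ ∑-cong V (λ x → ∑-*ˡ V ⟦ U x ⟧ _) ⟩
    ∑ V (λ x → ⟦ U x ⟧ * ∑ V (λ c → ⟦ inBall c x ⟧))  ≡⟨ ∑-cong V (λ x → cong (⟦ U x ⟧ *_) (ball-size n x R)) ⟩
    ∑ V (λ x → ⟦ U x ⟧ * vol)                         ≡⟨ ∑-*ʳ V vol _ ⟩
    card U * vol                                      ∎
    where open ≡-Reasoning

  ∑-cost : ∀ U → ∑ V (cost U) ≡ card U * shellVol
  ∑-cost U = begin
    ∑ V (cost U)                                 ≡⟨ ∑-comm V V (λ c x → ⟦ U x ⟧ * shell c x) ⟩
    ∑ V (λ x → ∑ V (λ c → ⟦ U x ⟧ * shell c x))  ≡⟨ ∑-cong V (λ x → ∑-*ˡ V ⟦ U x ⟧ _) ⟩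
    ∑ V (λ x → ⟦ U x ⟧ * ∑ V (λ c → shell c x))  ≡⟨ ∑-cong V (λ x → cong (⟦ U x ⟧ *_) (∑-shell x)) ⟩
    ∑ V (λ x → ⟦ U x ⟧ * shellVol)               ≡⟨ ∑-*ʳ V shellVol _ ⟩
    card U * shellVol                            ∎
    where
    open ≡-Reasoning
    ∑-shell : ∀ x → ∑ V (λ c → shell c x) ≡ shellVol
    ∑-shell x = trans (∑-distrib-+ V _ _) (cong₂ _+_ (sphere-size n x R) (sphere-size n x (suc R)))

  card-split : ∀ U c → card U ≡ gain U c + card (U ∖ball c)
  card-split U c = trans (∑-cong V (λ x → ⟦⟧-split (U x) (inBall c x))) (∑-distrib-+ V _ _)

  -- By double counting, some centre meeting U has cost/gain at most the average shellVol/vol.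
  good-centre : ∀ U {x} → U x ≡ true → ∃[ c ] (0 < gain U c × cost U c * vol ≤ gain U c * shellVol)
  good-centre U {x} Ux
    with ∑-averaging V (λ c → cost U c * vol) (λ c → gain U c * shellVol) (gain U)
                     ∑cost≡∑gain (∈-allVertices n x) 0<gain[x] (λ c eq → cong (_* shellVol) eq)
    where
    ∑cost≡∑gain : ∑ V (λ c → cost U c * vol) ≡ ∑ V (λ c → gain U c * shellVol)
    ∑cost≡∑gain = begin
      ∑ V (λ c → cost U c * vol)       ≡⟨ ∑-*ʳ V vol (cost U) ⟩
      ∑ V (cost U) * vol               ≡⟨ cong (_* vol) (∑-cost U) ⟩
      card U * shellVol * vol          ≡⟨ *-assoc (card U) shellVol vol ⟩
      card U * (shellVol * vol)        ≡⟨ cong (card U *_) (*-comm shellVol vol) ⟩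
      card U * (vol * shellVol)        ≡⟨ *-assoc (card U) vol shellVol ⟨
      card U * vol * shellVol          ≡⟨ cong (_* shellVol) (∑-gain U) ⟨
      ∑ V (gain U) * shellVol          ≡⟨ ∑-*ʳ V shellVol (gain U) ⟨
      ∑ V (λ c → gain U c * shellVol)  ∎
      where open ≡-Reasoning
    0<gain[x] : 0 < gain U x
    0<gain[x] = ≤-trans (≤-reflexive (cong ⟦_⟧ (sym x∈U∩B))) (≤-∑ V (λ y → ⟦ U y ∧ inBall x y ⟧) (∈-allVertices n x))
      where
      x∈U∩B : (U x ∧ inBall x x) ≡ true
      x∈U∩B rewrite Ux | dist-self x = refl
  ... | c , _ , 0<gain , good = c , 0<gain , good

  -- charge cs U x counts the balls of cs on whose shell x lies while x is still uncovered.
  charge : List (Vertex n) → VSubset n → Vertex n → ℕ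
  charge [] U x = 0
  charge (c ∷ cs) U x = ⟦ U x ⟧ * shell c x + charge cs (U ∖ball c) x

  label : List (Vertex n) → Vertex n → ℕ
  label [] x = 0
  label (c ∷ cs) x = if inBall c x then 0 else suc (label cs x)

  record Cover (U : VSubset n) : Set where
    field
      centres : List (Vertex n)
      covers : ∀ x → U x ≡ true → label centres x < length centres
      charge-bound : ∑ V (charge centres U) * vol ≤ shellVol * card U

  ∖ball-keeps : ∀ {U : VSubset n} c {x} → U x ≡ true → inBall c x ≡ false → (U ∖ball c) x ≡ true
  ∖ball-keeps {U} c {x} Ux x∉B rewrite Ux | x∉B = refl

  cons-cover : ∀ U c → cost U c * vol ≤ gain U c * shellVol → Cover (U ∖ball c) → Cover U
  cons-cover U c good cov = record
    { centres = c ∷ cs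
    ; covers = covers
    ; charge-bound = begin
        ∑ V (charge (c ∷ cs) U) * vol              ≡⟨ cong (_* vol) (∑-distrib-+ V _ _) ⟩
        (cost U c + ∑ V (charge cs U′)) * vol      ≡⟨ *-distribʳ-+ vol (cost U c) _ ⟩
        cost U c * vol + ∑ V (charge cs U′) * vol  ≤⟨ +-mono-≤ good (Cover.charge-bound cov) ⟩
        gain U c * shellVol + shellVol * card U′   ≡⟨ cong (_+ shellVol * card U′) (*-comm (gain U c) shellVol) ⟩
        shellVol * gain U c + shellVol * card U′   ≡⟨ *-distribˡ-+ shellVol (gain U c) (card U′) ⟨
        shellVol * (gain U c + card U′)            ≡⟨ cong (shellVol *_) (card-split U c) ⟨
        shellVol * card U                          ∎
    }
    where
    open ≤-Reasoning
    U′ : VSubset n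
    U′ = U ∖ball c
    cs : List (Vertex n)
    cs = Cover.centres cov
    covers : ∀ x → U x ≡ true → label (c ∷ cs) x < suc (length cs)
    covers x Ux with inBall c x in x∈B
    ... | true = s≤s z≤n
    ... | false = s≤s (Cover.covers cov x (∖ball-keeps {U} c Ux x∈B))

  -- k is fuel: every step removes at least one vertex of U.
  greedy : ∀ k U → card U ≤ k → Cover U
  greedy k U card≤k with any? (λ x → U x Bool.≟ true) V
  ... | no U≡∅ = record
    { centres = []
    ; covers = λ x Ux → ⊥-elim (U≡∅ (lose (∈-allVertices n x) Ux))
    ; charge-bound = ≤-trans (≤-reflexive (cong (_* vol) (∑-zero V))) z≤n
    }
  ... | yes U≢∅ with find U≢∅
  ... | x , _ , Ux with good-centre U Ux | k
  ...   | c , 0<gain , good | zero = ⊥-elim (<-irrefl refl (≤-trans (<-≤-trans 0<gain (gain≤card c)) card≤k))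
    where
    gain≤card : ∀ c → gain U c ≤ card U
    gain≤card c = ≤-trans (m≤m+n _ _) (≤-reflexive (sym (card-split U c)))
  ...   | c , 0<gain , good | suc k′ = cons-cover U c good (greedy k′ (U ∖ball c) card′≤k′)
    where
    card′≤k′ : card (U ∖ball c) ≤ k′
    card′≤k′ = ≤-pred (≤-trans (+-monoˡ-≤ _ 0<gain) (≤-trans (≤-reflexive (sym (card-split U c))) card≤k))

-- Bounding the integrity

length≤card : ∀ {n} (P : VSubset n) xs → Unique xs → All (λ x → P x ≡ true) xs → length xs ≤ card P
length≤card P [] _ _ = z≤n
length≤card {n} P (x ∷ xs) (x∉xs ∷ unique) (Px ∷ all) = begin-strict
  length xs  ≤⟨ length≤card P′ xs unique (All.zipWith P′-holds (x∉xs , all)) ⟩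
  card P′    <⟨ ∑-mono-< V (∈-allVertices n x) P′≤P P′x<Px ⟩
  card P     ∎
  where
  open ≤-Reasoning
  V : List (Vertex n)
  V = allVertices n
  P′ : VSubset n
  P′ w = P w ∧ not (does (≡-dec Bool._≟_ w x))
  P′-holds : ∀ {w} → x ≢ w × P w ≡ true → P′ w ≡ true
  P′-holds {w} (x≢w , Pw) with ≡-dec Bool._≟_ w x
  ... | yes w≡x = ⊥-elim (x≢w (sym w≡x))
  ... | no _ rewrite Pw = refl
  P′≤P : ∀ {w} → w ∈ V → ⟦ P′ w ⟧ ≤ ⟦ P w ⟧
  P′≤P {w} _ with P w
  ... | true = ⟦⟧≤1 _
  ... | false = z≤n
  P′x<Px : ⟦ P′ x ⟧ < ⟦ P x ⟧
  P′x<Px with ≡-dec Bool._≟_ x x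
  ... | yes _ rewrite Px = s≤s z≤n
  ... | no x≢x = ⊥-elim (x≢x refl)

HasComponent : ∀ {n} → VSubset n → ℕ → Set
HasComponent S m = ∃[ xs ] (Unique xs × SameComponent S xs × length xs ≡ m)

-- A largest component cannot be computed here, but under ¬¬ we may ask, at each of at most B
-- steps, whether a larger component exists.
¬¬maxComp : ∀ {n} (S : VSubset n) B → CompBound S B → ¬ ¬ (∃[ m ] IsMaxComp S m)
¬¬maxComp S B bound = grow B 0 ([] , [] , [] , refl) ≤-refl
  where
  grow : ∀ d m → HasComponent S m → B ≤ m + d → ¬ ¬ (∃[ m ] IsMaxComp S m)
  grow zero m comp B≤m ¬max =
    ¬max (m , (λ xs u sc → ≤-trans (bound xs u sc) (≤-trans B≤m (≤-reflexive (+-identityʳ m)))) , comp)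
  grow (suc d) m comp B≤m+1+d ¬max = ¬¬-excluded-middle larger?
    where
    larger? : ¬ Dec (∃[ xs ] (Unique xs × SameComponent S xs × m < length xs))
    larger? (yes (xs , u , sc , m<len)) = grow d (length xs) (xs , u , sc , refl)
      (≤-trans B≤m+1+d (≤-trans (≤-reflexive (+-suc m d)) (+-monoˡ-≤ d m<len))) ¬max
    larger? (no none) = ¬max (m , (λ xs u sc → ≮⇒≥ (λ m<len → none (xs , u , sc , m<len))) , comp)

integrity≤ : ∀ {n k} → IsIntegrity n k → ∀ (S : VSubset n) B → CompBound S B → k ≤ card S + B
integrity≤ {n} {k} (_ , minimal) S B bound = decidable-stable (k ≤? card S + B) λ k≰ →
  ¬¬maxComp S B bound λ { (m , max@(_ , xs , u , sc , len≡m)) →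
    k≰ (≤-trans (minimal S m max) (+-monoʳ-≤ (card S) (≤-trans (≤-reflexive (sym len≡m)) (bound xs u sc)))) }

everything : ∀ {n} → VSubset n
everything _ = true

card-everything : ∀ n → card {n} everything ≡ 2 ^ n
card-everything n = trans (∑-const (allVertices n) 1) (trans (*-identityˡ _) (length-allVertices n))

integrity≤2^n : ∀ {n k} → IsIntegrity n k → k ≤ 2 ^ n
integrity≤2^n {n} integrity =
  ≤-trans (integrity≤ integrity everything 0 no-component) (≤-reflexive (trans (+-identityʳ _) (card-everything n)))
  where
  no-component : CompBound everything 0
  no-component [] _ _ = z≤n
  no-component (_ ∷ _) _ ((here () ∷ _) ∷ _)
  no-component (_ ∷ _) _ ((step () _ _ ∷ _) ∷ _)

module Separator (n R : ℕ) where
  open BallCover n R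

  cover : Cover (everything {n})
  cover = greedy (card (everything {n})) everything ≤-refl

  centres : List (Vertex n)
  centres = Cover.centres cover

  separator : VSubset n
  separator x = any (λ y → not (label centres y ≡ᵇ label centres x)) (neighbours x)

  shell⇒charged : ∀ {U : VSubset n} {x} c cs → U x ≡ true → 0 < shell c x → 0 < charge (c ∷ cs) U x
  shell⇒charged {U} {x} c cs Ux 0<shell rewrite Ux =
    <-≤-trans 0<shell (≤-trans (≤-reflexive (sym (*-identityˡ _))) (m≤m+n _ _))

  -- A vertex x whose neighbour y carries another label lies on the inner shell of the first
  -- ball containing x, or on the outer shell of the earlier ball containing y.
  label-change⇒charged : ∀ cs (U : VSubset n) {x y} → U x ≡ true → y ∈ neighbours x →
                         (label cs y ≡ᵇ label cs x) ≡ false → 0 < charge cs U x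
  label-change⇒charged (c ∷ cs) U {x} {y} Ux y∈N[x] changed with inBall c x in x∈B | inBall c y in y∈B
  label-change⇒charged (c ∷ cs) U Ux y∈N[x] () | true | true
  ... | true | false = shell⇒charged {U} c cs Ux (inner-shell c x (≤-antisym (≤ᵇ≡true⇒≤ x∈B) R≤d))
    where
    R≤d : R ≤ dist x c
    R≤d = ≤-pred (≤-trans (≤ᵇ≡false⇒> y∈B) (proj₁ (dist-neighbour c y∈N[x])))
  ... | false | true = shell⇒charged {U} c cs Ux (outer-shell c x (≤-antisym d≤1+R (≤ᵇ≡false⇒> x∈B)))
    where
    d≤1+R : dist x c ≤ suc R
    d≤1+R = ≤-trans (proj₂ (dist-neighbour c y∈N[x])) (s≤s (≤ᵇ≡true⇒≤ y∈B))
  ... | false | false =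
    ≤-trans (label-change⇒charged cs (U ∖ball c) (∖ball-keeps {U} c Ux x∈B) y∈N[x] changed) (m≤n+m _ _)

  separator⇒charged : ∀ x → ⟦ separator x ⟧ ≤ charge centres everything x
  separator⇒charged x with separator x in x∈S
  ... | false = z≤n
  ... | true with find (any⁻ _ (neighbours x) (Equivalence.from T-≡ x∈S))
  ...   | y , y∈N[x] , changed = label-change⇒charged centres everything refl y∈N[x] (Equivalence.to T-not-≡ changed)

  card-separator : card separator * vol ≤ shellVol * 2 ^ n
  card-separator = begin
    card separator * vol                   ≤⟨ *-monoˡ-≤ vol (∑-mono-≤ V (λ {x} _ → separator⇒charged x)) ⟩
    ∑ V (charge centres everything) * vol  ≤⟨ Cover.charge-bound cover ⟩
    shellVol * card (everything {n})       ≡⟨ cong (shellVol *_) (card-everything n) ⟩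
    shellVol * 2 ^ n                       ∎
    where open ≤-Reasoning

  label-neighbour : ∀ {u v} → separator u ≡ false → v ∈ neighbours u → label centres v ≡ label centres u
  label-neighbour {u} {v} u∉S v∈N[u] with label centres v ≡ᵇ label centres u in same
  ... | true = ≡ᵇ≡true⇒≡ same
  ... | false = ⊥-elim (subst T u∉S (any⁺ _ (lose v∈N[u] (subst (T ∘ not) (sym same) _))))

  Reach⇒label≡ : ∀ {u w} → Reach separator u w → label centres u ≡ label centres w
  Reach⇒label≡ (here _) = refl
  Reach⇒label≡ (step u∉S adj path) =
    trans (sym (label-neighbour u∉S (Adj⇒∈neighbours adj))) (Reach⇒label≡ path)

  centreOf : List (Vertex n) → Vertex n → Vertex n
  centreOf [] h = h
  centreOf (c ∷ cs) h = if inBall c h then c else centreOf cs h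

  same-label⇒inBall : ∀ cs w h → label cs w ≡ label cs h → label cs h < length cs →
                      inBall (centreOf cs h) w ≡ true
  same-label⇒inBall (c ∷ cs) w h same covered with inBall c h in h∈B | inBall c w in w∈B
  ... | true  | true  = w∈B
  same-label⇒inBall (c ∷ cs) w h () covered | true  | false
  same-label⇒inBall (c ∷ cs) w h () covered | false | true
  ... | false | false = same-label⇒inBall cs w h (suc-injective same) (≤-pred covered)

  separator-components : CompBound separator vol
  separator-components [] _ _ = z≤n
  separator-components (h ∷ t) unique (reach-from-h ∷ _) = begin
    length (h ∷ t)                 ≤⟨ length≤card (inBall c) (h ∷ t) unique (All.map in-ball reach-from-h) ⟩
    card (inBall c)                ≡⟨ ∑-cong V (λ x → cong (λ d → ⟦ d ≤ᵇ R ⟧) (dist-comm x c)) ⟩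
    ∑ V (λ x → ⟦ dist c x ≤ᵇ R ⟧)  ≡⟨ ball-size n c R ⟩
    vol                            ∎
    where
    open ≤-Reasoning
    c : Vertex n
    c = centreOf centres h
    in-ball : ∀ {w} → Reach separator h w → inBall c w ≡ true
    in-ball {w} path = same-label⇒inBall centres w h (sym (Reach⇒label≡ path))
      (Cover.covers cover h refl)

integrity*ball≤ : ∀ n R {k} → IsIntegrity n k →
                  k * ball n R ≤ (n C R + n C suc R) * 2 ^ n + ball n R * ball n R
integrity*ball≤ n R {k} integrity = begin
  k * b                                ≤⟨ *-monoˡ-≤ b (integrity≤ integrity separator b separator-components) ⟩
  (card separator + b) * b             ≡⟨ *-distribʳ-+ b (card separator) b ⟩
  card separator * b + b * b           ≤⟨ +-monoˡ-≤ (b * b) card-separator ⟩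
  (n C R + n C suc R) * 2 ^ n + b * b  ∎
  where
  open ≤-Reasoning
  open Separator n R
  b : ℕ
  b = ball n R

-- Binomial coefficients and Hamming balls

-- _C_ binds more weakly than _*_, hence the parentheses in (n C k) * m.
C-ratio : ∀ n k → (n C suc k) * suc k ≡ (n C k) * (n ∸ k)
C-ratio zero k = sym (trans (cong ((0 C k) *_) (0∸n≡0 k)) (*-zeroʳ (0 C k)))
C-ratio (suc n) zero = trans (*-identityʳ _) (trans (nC1≡n (suc n)) (sym (*-identityˡ (suc n))))
C-ratio (suc n) (suc k) = begin
  (suc n C suc (suc k)) * suc (suc k)  ≡⟨ cong (_* suc (suc k)) (nCk+nC[k+1]≡[n+1]C[k+1] n (suc k)) ⟨
  (Y + Z) * suc (suc k)                ≡⟨ expand Y Z k ⟩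
  Y * suc k + Y + Z * suc (suc k)      ≡⟨ cong₂ (λ p q → p + Y + q) (C-ratio n k) (C-ratio n (suc k)) ⟩
  X * (n ∸ k) + Y + Y * (n ∸ suc k)    ≡⟨ collect X Y (n ∸ k) (n ∸ suc k) ⟩
  X * (n ∸ k) + Y * suc (n ∸ suc k)    ≡⟨ cong (X * (n ∸ k) +_) Y*[n∸k] ⟩
  X * (n ∸ k) + Y * (n ∸ k)            ≡⟨ *-distribʳ-+ (n ∸ k) X Y ⟨
  (X + Y) * (n ∸ k)                    ≡⟨ cong (_* (n ∸ k)) (nCk+nC[k+1]≡[n+1]C[k+1] n k) ⟩
  (suc n C suc k) * (n ∸ k)            ∎
  where
  open ≡-Reasoning
  X : ℕ
  X = n C k
  Y : ℕ
  Y = n C suc k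
  Z : ℕ
  Z = n C suc (suc k)
  expand : ∀ y z k → (y + z) * (2 + k) ≡ y * (1 + k) + y + z * (2 + k)
  expand = solve-∀
  collect : ∀ x y a b → x * a + y + y * b ≡ x * a + y * (1 + b)
  collect = solve-∀
  Y*[n∸k] : Y * suc (n ∸ suc k) ≡ Y * (n ∸ k)
  Y*[n∸k] with k <? n
  ... | yes k<n = cong (Y *_) (sym (+-∸-assoc 1 k<n))
  ... | no k≮n rewrite k>n⇒nCk≡0 (s≤s (≮⇒≥ k≮n)) = refl

C-ratio≤ : ∀ {n i a d} → 0 < n ∸ i → a ≤ suc i → n ∸ i ≤ d → (n C suc i) * a ≤ (n C i) * d
C-ratio≤ {n} {i} {a} {d} 0<n∸i a≤1+i n∸i≤d = *-cancelʳ-≤′ (n ∸ i) 0<n∸i (begin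
  (n C suc i) * a * (n ∸ i)    ≡⟨ *-assoc (n C suc i) a (n ∸ i) ⟩
  (n C suc i) * (a * (n ∸ i))  ≤⟨ *-monoʳ-≤ (n C suc i) (*-mono-≤ a≤1+i n∸i≤d) ⟩
  (n C suc i) * (suc i * d)    ≡⟨ *-assoc (n C suc i) (suc i) d ⟨
  (n C suc i) * suc i * d      ≡⟨ cong (_* d) (C-ratio n i) ⟩
  (n C i) * (n ∸ i) * d        ≡⟨ xy∙z≈xz∙y (n C i) (n ∸ i) d ⟩
  (n C i) * d * (n ∸ i)        ∎)
  where open ≤-Reasoning

C-ratio≥ : ∀ {n i N D} → suc i ≤ N → D ≤ n ∸ i → (n C i) * D ≤ (n C suc i) * N
C-ratio≥ {n} {i} {N} {D} 1+i≤N D≤n∸i = *-cancelʳ-≤′ (suc i) z<s (begin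
  (n C i) * D * suc i      ≡⟨ *-assoc (n C i) D (suc i) ⟩
  (n C i) * (D * suc i)    ≤⟨ *-monoʳ-≤ (n C i) (*-mono-≤ D≤n∸i 1+i≤N) ⟩
  (n C i) * ((n ∸ i) * N)  ≡⟨ *-assoc (n C i) (n ∸ i) N ⟨
  (n C i) * (n ∸ i) * N    ≡⟨ cong (_* N) (C-ratio n i) ⟨
  (n C suc i) * suc i * N  ≡⟨ xy∙z≈xz∙y (n C suc i) (suc i) N ⟩
  (n C suc i) * N * suc i  ∎)
  where open ≤-Reasoning

C-ratio≥-iterate : ∀ {n N D} u i → (∀ i′ → i′ < i + u → (n C i′) * D ≤ (n C suc i′) * N) →
                   (n C i) * D ^ u ≤ (n C (i + u)) * N ^ u
C-ratio≥-iterate {n} zero i _ = ≤-reflexive (cong (λ m → (n C m) * 1) (sym (+-identityʳ i)))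
C-ratio≥-iterate {n} {N} {D} (suc u) i ratio = begin
  (n C i) * (D * D ^ u)            ≡⟨ *-assoc (n C i) D (D ^ u) ⟨
  (n C i) * D * D ^ u              ≤⟨ *-monoˡ-≤ (D ^ u) (ratio i (≤-trans (s≤s (m≤m+n i u)) (≤-reflexive (sym (+-suc i u))))) ⟩
  (n C suc i) * N * D ^ u          ≡⟨ xy∙z≈xz∙y (n C suc i) N (D ^ u) ⟩
  (n C suc i) * D ^ u * N          ≤⟨ *-monoˡ-≤ N (C-ratio≥-iterate u (suc i) (λ i′ lt → ratio i′ (≤-trans lt (≤-reflexive (sym (+-suc i u)))))) ⟩
  (n C (suc i + u)) * N ^ u * N    ≡⟨ cong (λ m → (n C m) * N ^ u * N) (sym (+-suc i u)) ⟩
  (n C (i + suc u)) * N ^ u * N    ≡⟨ x∙yz≈xz∙y (n C (i + suc u)) N (N ^ u) ⟨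
  (n C (i + suc u)) * (N * N ^ u)  ∎
  where open ≤-Reasoning

C-ratio≤-iterate : ∀ {n R t a d} → (∀ i → R ≤ i + t → suc i ≤ R → (n C suc i) * a ≤ (n C i) * d) →
                   ∀ j → j ≤ t → j ≤ R → (n C R) * a ^ j ≤ (n C (R ∸ j)) * d ^ j
C-ratio≤-iterate ratio zero _ _ = ≤-refl
C-ratio≤-iterate {n} {R} {t} {a} {d} ratio (suc j) 1+j≤t 1+j≤R = begin
  (n C R) * (a * a ^ j)      ≡⟨ x∙yz≈xz∙y (n C R) a (a ^ j) ⟩
  (n C R) * a ^ j * a        ≤⟨ *-monoˡ-≤ a (C-ratio≤-iterate ratio j (<⇒≤ 1+j≤t) (<⇒≤ 1+j≤R)) ⟩
  (n C (R ∸ j)) * d ^ j * a  ≡⟨ cong (λ m → (n C m) * d ^ j * a) (+-∸-assoc 1 {R} {suc j} 1+j≤R) ⟩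
  (n C suc i) * d ^ j * a    ≡⟨ xy∙z≈xz∙y (n C suc i) (d ^ j) a ⟩
  (n C suc i) * a * d ^ j    ≤⟨ *-monoˡ-≤ (d ^ j) (ratio i R≤i+t 1+i≤R) ⟩
  (n C i) * d * d ^ j        ≡⟨ *-assoc (n C i) d (d ^ j) ⟩
  (n C i) * (d * d ^ j)      ∎
  where
  open ≤-Reasoning
  i : ℕ
  i = R ∸ suc j
  i+1+j≡R : i + suc j ≡ R
  i+1+j≡R = m∸n+n≡m 1+j≤R
  R≤i+t : R ≤ i + t
  R≤i+t = ≤-trans (≤-reflexive (sym i+1+j≡R)) (+-monoʳ-≤ i 1+j≤t)
  1+i≤R : suc i ≤ R
  1+i≤R = ≤-trans (m≤m+n (suc i) j) (≤-reflexive (trans (sym (+-suc i j)) i+1+j≡R))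

C-next≤ : ∀ {n k} c → n ∸ k ≤ c * suc k → n C suc k ≤ c * (n C k)
C-next≤ {n} {k} c n∸k≤c[1+k] = *-cancelʳ-≤′ (suc k) z<s (begin
  (n C suc k) * suc k    ≡⟨ C-ratio n k ⟩
  (n C k) * (n ∸ k)      ≤⟨ *-monoʳ-≤ (n C k) n∸k≤c[1+k] ⟩
  (n C k) * (c * suc k)  ≡⟨ *-assoc (n C k) c (suc k) ⟨
  (n C k) * c * suc k    ≡⟨ cong (_* suc k) (*-comm (n C k) c) ⟩
  c * (n C k) * suc k    ∎)
  where open ≤-Reasoning

-- The t top terms of the ball are each at least C(n,R)/2: consecutive ratios are at least a/(a+e).
t*C≤2*ball : ∀ {n R t a e} → R ≤ n → t ≤ R → a + t ≡ suc R → R + (a + e) ≡ n + t → 2 * t * e ≤ a + e →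
             t * (n C R) ≤ 2 * ball n R
t*C≤2*ball {n} {R} {t} {a} {e} R≤n t≤R a+t≡1+R R+d≡n+t 2te≤d =
  ≤-trans (t*c≤∑≤ t R (n C R) (λ i → 2 * (n C i)) (m≤n⇒m≤1+n t≤R) C≤2C[R∸j]) (≤-reflexive (∑≤-*ˡ R 2 (n C_)))
  where
  d : ℕ
  d = a + e
  0<a : 0 < a
  0<a = +-cancelʳ-< t 0 a (≤-trans (s≤s t≤R) (≤-reflexive (sym a+t≡1+R)))
  0<d : 0 < d
  0<d = ≤-trans 0<a (m≤m+n a e)
  ratio : ∀ i → R ≤ i + t → suc i ≤ R → (n C suc i) * a ≤ (n C i) * d
  ratio i R≤i+t 1+i≤R = C-ratio≤ (m<n⇒0<n∸m (≤-trans 1+i≤R R≤n)) a≤1+i n∸i≤d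
    where
    a≤1+i : a ≤ suc i
    a≤1+i = +-cancelʳ-≤ t a (suc i) (≤-trans (≤-reflexive a+t≡1+R) (s≤s R≤i+t))
    n∸i≤d : n ∸ i ≤ d
    n∸i≤d = +-cancelˡ-≤ R (n ∸ i) d (begin
      R + (n ∸ i)      ≤⟨ +-monoˡ-≤ (n ∸ i) R≤i+t ⟩
      i + t + (n ∸ i)  ≡⟨ +-comm (i + t) (n ∸ i) ⟩
      n ∸ i + (i + t)  ≡⟨ +-assoc (n ∸ i) i t ⟨
      n ∸ i + i + t    ≡⟨ cong (_+ t) (m∸n+n≡m (≤-trans (n≤1+n i) (≤-trans 1+i≤R R≤n))) ⟩
      n + t            ≡⟨ R+d≡n+t ⟨
      R + d            ∎)
      where open ≤-Reasoning
  C≤2C[R∸j] : ∀ j → j < t → n C R ≤ 2 * (n C (R ∸ j))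
  C≤2C[R∸j] j j<t = *-cancelʳ-≤′ (d ^ j) (m^n>0 d j) (begin
    (n C R) * d ^ j              ≤⟨ *-monoʳ-≤ (n C R) ([a+e]^j≤2*a^j a e j 0<d (≤-trans (*-monoˡ-≤ e (*-monoʳ-≤ 2 (<⇒≤ j<t))) 2te≤d)) ⟩
    (n C R) * (2 * a ^ j)        ≡⟨ x∙yz≈y∙xz (n C R) 2 (a ^ j) ⟩
    2 * ((n C R) * a ^ j)        ≤⟨ *-monoʳ-≤ 2 (C-ratio≤-iterate ratio j (<⇒≤ j<t) (≤-trans (<⇒≤ j<t) t≤R)) ⟩
    2 * ((n C (R ∸ j)) * d ^ j)  ≡⟨ *-assoc 2 (n C (R ∸ j)) (d ^ j) ⟨
    2 * (n C (R ∸ j)) * d ^ j    ∎)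
    where
    open ≤-Reasoning
    instance
      d≢0 : NonZero d
      d≢0 = >-nonZero 0<d

ball*D^u≤ : ∀ {n R u D} → 0 < D → R + u + D ≤ suc n → ball n R * D ^ u ≤ (R + u) ^ u * 2 ^ n
ball*D^u≤ {n} {R} {u} {D} 0<D N+D≤1+n = begin
  ball n R * D ^ u                    ≡⟨ ∑≤-*ʳ R (n C_) (D ^ u) ⟨
  ∑≤ R (λ i → (n C i) * D ^ u)        ≤⟨ ∑≤-mono R (λ i i≤R → C-ratio≥-iterate u i (ratio i≤R)) ⟩
  ∑≤ R (λ i → (n C (i + u)) * N ^ u)  ≡⟨ ∑≤-*ʳ R (λ i → n C (i + u)) (N ^ u) ⟩
  ∑≤ R (λ i → n C (i + u)) * N ^ u    ≤⟨ *-monoˡ-≤ (N ^ u) (≤-trans (∑≤-shift (n C_) u R) (ball≤2^n n (R + u))) ⟩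
  2 ^ n * N ^ u                       ≡⟨ *-comm (2 ^ n) (N ^ u) ⟩
  N ^ u * 2 ^ n                       ∎
  where
  open ≤-Reasoning
  N : ℕ
  N = R + u
  ratio : ∀ {i} → i ≤ R → ∀ i′ → i′ < i + u → (n C i′) * D ≤ (n C suc i′) * N
  ratio i≤R i′ i′<i+u = C-ratio≥ 1+i′≤N (m+n≤o⇒m≤o∸n D (≤-pred (begin
    suc (D + i′)  ≡⟨ +-suc D i′ ⟨
    D + suc i′    ≤⟨ +-monoʳ-≤ D 1+i′≤N ⟩
    D + N         ≡⟨ +-comm D N ⟩
    N + D         ≤⟨ N+D≤1+n ⟩
    suc n         ∎)))
    where
    1+i′≤N : suc i′ ≤ N
    1+i′≤N = ≤-trans i′<i+u (+-monoˡ-≤ u i≤R)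

-- Bernoulli in blocks of w: each block of w factors (N+g)/N multiplies by at least 2.
ball*2^j≤2^n : ∀ {n R u D g w j v} → 0 < R + u → R + u + g ≤ D → R + u + D ≤ suc n → R + u ≤ w * g →
               w * j + v ≡ u → ball n R * 2 ^ j ≤ 2 ^ n
ball*2^j≤2^n {n} {R} {u} {D} {g} {w} {j} {v} 0<N N+g≤D N+D≤1+n N≤wg wj+v≡u =
  *-cancelʳ-≤′ (N ^ u) (m^n>0 N u) (begin
    ball n R * 2 ^ j * N ^ u    ≡⟨ *-assoc (ball n R) (2 ^ j) (N ^ u) ⟩
    ball n R * (2 ^ j * N ^ u)  ≤⟨ *-monoʳ-≤ (ball n R) 2^j*N^u≤D^u ⟩
    ball n R * D ^ u            ≤⟨ ball*D^u≤ {n} {R} {u} (<-≤-trans 0<N (≤-trans (m≤m+n N g) N+g≤D)) N+D≤1+n ⟩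
    N ^ u * 2 ^ n               ≡⟨ *-comm (N ^ u) (2 ^ n) ⟩
    2 ^ n * N ^ u               ∎)
  where
  open ≤-Reasoning
  N : ℕ
  N = R + u
  instance
    N≢0 : NonZero N
    N≢0 = >-nonZero 0<N
  2^j*N^u≤D^u : 2 ^ j * N ^ u ≤ D ^ u
  2^j*N^u≤D^u = begin
    2 ^ j * N ^ u                    ≡⟨ cong (λ m → 2 ^ j * N ^ m) wj+v≡u ⟨
    2 ^ j * N ^ (w * j + v)          ≡⟨ cong (2 ^ j *_) (^-distribˡ-+-* N (w * j) v) ⟩
    2 ^ j * (N ^ (w * j) * N ^ v)    ≡⟨ *-assoc (2 ^ j) _ _ ⟨
    2 ^ j * N ^ (w * j) * N ^ v      ≡⟨ cong (λ m → 2 ^ j * m * N ^ v) (^-*-assoc N w j) ⟨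
    2 ^ j * (N ^ w) ^ j * N ^ v      ≤⟨ *-mono-≤ (2^j*Y^j≤X^j _ _ j (2*N^w≤[N+g]^w N g w 0<N N≤wg)) (^-monoˡ-≤ v (m≤m+n N g)) ⟩
    ((N + g) ^ w) ^ j * (N + g) ^ v  ≡⟨ cong (_* (N + g) ^ v) (^-*-assoc (N + g) w j) ⟩
    (N + g) ^ (w * j) * (N + g) ^ v  ≡⟨ ^-distribˡ-+-* (N + g) (w * j) v ⟨
    (N + g) ^ (w * j + v)            ≡⟨ cong ((N + g) ^_) wj+v≡u ⟩
    (N + g) ^ u                      ≤⟨ ^-monoˡ-≤ u N+g≤D ⟩
    D ^ u                            ∎

-- Choice of the radius

-- With r ≈ √(3n(L + 2)) and R = ⌊n/2⌋ − r: Bernoulli's inequality in blocks of w ≈ n/r gives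
-- b · 2^j ≤ 2^n with n ≤ 4^j, and the t ≈ n/(20r) coefficients just below C(n,R) are each at
-- least C(n,R)/2, so s · t ≤ 8b with n ≤ 57600 L t².
module RadiusChoice (n L : ℕ) (20≤L : 20 ≤ L) (2^L≤n : 2 ^ L ≤ n) (n<2^[1+L] : n < 2 * 2 ^ L) where

  M : ℕ
  M = n * (L + 2)

  0<n : 0 < n
  0<n = <-≤-trans (m^n>0 2 L) 2^L≤n

  n≤M : n ≤ M
  n≤M = m≤m*n n (L + 2) {{subst NonZero (+-comm 2 L) _}}

  n≤3M : n ≤ 3 * M
  n≤3M = ≤-trans n≤M (m≤m+n M (M + (M + 0)))

  4800[L+2]≤n : 4800 * (L + 2) ≤ n
  4800[L+2]≤n = ≤-trans (c*[L+2]≤2^L 4800 20 (≤ᵇ⇒≤ (4800 * (20 + 2)) (2 ^ 20) _) L 20≤L) 2^L≤n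

  q : ℕ
  q = proj₁ (isqrt (3 * M))

  q²≤3M : q * q ≤ 3 * M
  q²≤3M = proj₁ (proj₂ (isqrt (3 * M)))

  3M<[1+q]² : 3 * M < suc q * suc q
  3M<[1+q]² = proj₂ (proj₂ (isqrt (3 * M)))

  r : ℕ
  r = suc q

  0<q : 0 < q
  0<q = ≰⇒> λ q≤0 → <⇒≱ 0<n (≤-trans n≤3M (≤-pred (≤-trans 3M<[1+q]² (*-mono-≤ (s≤s q≤0) (s≤s q≤0)))))

  r²≤12M : r * r ≤ 12 * M
  r²≤12M = begin
    r * r              ≤⟨ *-mono-≤ r≤q+q r≤q+q ⟩
    (q + q) * (q + q)  ≡⟨ square q ⟩
    4 * (q * q)        ≤⟨ *-monoʳ-≤ 4 q²≤3M ⟩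
    4 * (3 * M)        ≡⟨ *-assoc 4 3 M ⟨
    12 * M             ∎
    where
    open ≤-Reasoning
    r≤q+q : r ≤ q + q
    r≤q+q = +-monoˡ-≤ q 0<q
    square : ∀ q → (q + q) * (q + q) ≡ 4 * (q * q)
    square = solve-∀

  n≤r² : n ≤ r * r
  n≤r² = ≤-trans n≤3M (<⇒≤ 3M<[1+q]²)

  20r≤n : 20 * r ≤ n
  20r≤n = m*m≤n*n⇒m≤n (begin
    20 * r * (20 * r)   ≡⟨ square r ⟩
    400 * (r * r)       ≤⟨ *-monoʳ-≤ 400 r²≤12M ⟩
    400 * (12 * M)      ≡⟨ regroup n (L + 2) ⟩
    4800 * (L + 2) * n  ≤⟨ *-monoˡ-≤ n 4800[L+2]≤n ⟩
    n * n               ∎)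
    where
    open ≤-Reasoning
    square : ∀ r → 20 * r * (20 * r) ≡ 400 * (r * r)
    square = solve-∀
    regroup : ∀ n K → 400 * (12 * (n * K)) ≡ 4800 * K * n
    regroup = solve-∀

  h : ℕ
  h = ⌊ n /2⌋

  2h≤n : 2 * h ≤ n
  2h≤n = proj₁ (⌊n/2⌋-bounds n)

  n≤1+2h : n ≤ suc (2 * h)
  n≤1+2h = proj₂ (⌊n/2⌋-bounds n)

  2r≤h : 2 * r ≤ h
  2r≤h = *-cancelˡ-≤ 2 (≤-pred (begin
    suc (2 * (2 * r))  ≤⟨ subst (_< 20 * r) (*-assoc 2 2 r) (*-monoˡ-< r (≤ᵇ⇒≤ 5 20 _)) ⟩
    20 * r             ≤⟨ 20r≤n ⟩
    n                  ≤⟨ n≤1+2h ⟩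
    suc (2 * h)        ∎))
    where open ≤-Reasoning

  r+r≤h : r + r ≤ h
  r+r≤h = subst (_≤ h) (cong (r +_) (+-identityʳ r)) 2r≤h

  R : ℕ
  R = h ∸ r

  R+r≡h : R + r ≡ h
  R+r≡h = m∸n+n≡m (m+n≤o⇒n≤o r r+r≤h)

  r≤R : r ≤ R
  r≤R = +-cancelʳ-≤ r r R (subst (r + r ≤_) (sym R+r≡h) r+r≤h)

  0<R : 0 < R
  0<R = ≤-trans z<s r≤R

  2R+2r≡2h : 2 * R + 2 * r ≡ 2 * h
  2R+2r≡2h = trans (sym (*-distribˡ-+ 2 R r)) (cong (2 *_) R+r≡h)

  2R+2r≤n : 2 * R + 2 * r ≤ n
  2R+2r≤n = subst (_≤ n) (sym 2R+2r≡2h) 2h≤n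

  n≤1+2R+2r : n ≤ suc (2 * R + 2 * r)
  n≤1+2R+2r = subst (λ m → n ≤ suc m) (sym 2R+2r≡2h) n≤1+2h

  R≤n : R ≤ n
  R≤n = ≤-trans (m∸n≤m h r) (⌊n/2⌋≤n n)

  R≤n∸R : R ≤ n ∸ R
  R≤n∸R = m+n≤o⇒m≤o∸n R (≤-trans (+-monoʳ-≤ R (m≤m+n R 0)) (m+n≤o⇒m≤o (2 * R) 2R+2r≤n))

  t : ℕ
  t = n / (20 * r)

  t*20r≤n : t * (20 * r) ≤ n
  t*20r≤n = m/n*n≤m n (20 * r)

  n<[1+t]*20r : n < suc t * (20 * r)
  n<[1+t]*20r = m<[1+m/n]*n n (20 * r)

  0<t : 0 < t
  0<t = m≥n⇒m/n>0 20r≤n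

  t≤r : t ≤ r
  t≤r = ≤-trans (m≤m*n t 20) (*-cancelʳ-≤′ r z<s (begin
    t * 20 * r    ≡⟨ *-assoc t 20 r ⟩
    t * (20 * r)  ≤⟨ t*20r≤n ⟩
    n             ≤⟨ n≤r² ⟩
    r * r         ∎))
    where open ≤-Reasoning

  t≤R : t ≤ R
  t≤R = ≤-trans t≤r r≤R

  a : ℕ
  a = suc (R ∸ t)

  d : ℕ
  d = n ∸ R + t

  a+t≡1+R : a + t ≡ suc R
  a+t≡1+R = cong suc (m∸n+n≡m t≤R)

  R+d≡n+t : R + d ≡ n + t
  R+d≡n+t = trans (sym (+-assoc R (n ∸ R) t)) (cong (_+ t) (m+[n∸m]≡n R≤n))

  a≤d : a ≤ d
  a≤d = ≤-trans (s≤s (m∸n≤m R t)) (≤-trans 1+R≤n∸R (m≤m+n (n ∸ R) t))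
    where
    1+R≤n∸R : suc R ≤ n ∸ R
    1+R≤n∸R = m+n≤o⇒m≤o∸n (suc R) (≤-trans (≤-reflexive (double R)) (≤-trans (+-monoʳ-≤ (2 * R) z<s) 2R+2r≤n))
      where
      double : ∀ R → suc R + R ≡ 2 * R + 1
      double = solve-∀

  e : ℕ
  e = d ∸ a

  a+e≡d : a + e ≡ d
  a+e≡d = m+[n∸m]≡n a≤d

  e≤2r+2t : e ≤ 2 * r + 2 * t
  e≤2r+2t = +-cancelˡ-≤ (suc (R + R)) e (2 * r + 2 * t) (+-cancelʳ-≤ t _ _ (begin
    suc (R + R) + e + t                ≡⟨ cong (λ m → m + R + e + t) a+t≡1+R ⟨
    a + t + R + e + t                  ≡⟨ shuffle a t R e ⟩
    R + (a + e) + (t + t)              ≡⟨ cong (λ m → R + m + (t + t)) a+e≡d ⟩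
    R + d + (t + t)                    ≡⟨ cong (_+ (t + t)) R+d≡n+t ⟩
    n + t + (t + t)                    ≤⟨ +-monoˡ-≤ (t + t) (+-monoˡ-≤ t n≤1+2R+2r) ⟩
    suc (2 * R + 2 * r) + t + (t + t)  ≡⟨ collect R r t ⟩
    suc (R + R) + (2 * r + 2 * t) + t  ∎))
    where
    open ≤-Reasoning
    shuffle : ∀ a t R e → a + t + R + e + t ≡ R + (a + e) + (t + t)
    shuffle = solve-∀
    collect : ∀ R r t → suc (2 * R + 2 * r) + t + (t + t) ≡ suc (R + R) + (2 * r + 2 * t) + t
    collect = solve-∀

  n≤2[n∸R] : n ≤ 2 * (n ∸ R)
  n≤2[n∸R] = begin
    n                ≡⟨ m+[n∸m]≡n R≤n ⟨
    R + (n ∸ R)      ≤⟨ +-monoˡ-≤ (n ∸ R) R≤n∸R ⟩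
    n ∸ R + (n ∸ R)  ≡⟨ cong (n ∸ R +_) (+-identityʳ (n ∸ R)) ⟨
    2 * (n ∸ R)      ∎
    where open ≤-Reasoning

  8tr≤d : 8 * (t * r) ≤ d
  8tr≤d = *-cancelˡ-≤ 2 (begin
    2 * (8 * (t * r))  ≡⟨ *-assoc 2 8 (t * r) ⟨
    16 * (t * r)       ≤⟨ *-monoˡ-≤ (t * r) (≤ᵇ⇒≤ 16 20 _) ⟩
    20 * (t * r)       ≡⟨ x∙yz≈y∙xz 20 t r ⟩
    t * (20 * r)       ≤⟨ t*20r≤n ⟩
    n                  ≤⟨ n≤2[n∸R] ⟩
    2 * (n ∸ R)        ≤⟨ *-monoʳ-≤ 2 (m≤m+n (n ∸ R) t) ⟩
    2 * d              ∎)
    where open ≤-Reasoning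

  2te≤a+e : 2 * t * e ≤ a + e
  2te≤a+e = begin
    2 * t * e                ≤⟨ *-monoʳ-≤ (2 * t) e≤2r+2t ⟩
    2 * t * (2 * r + 2 * t)  ≤⟨ *-monoʳ-≤ (2 * t) (+-monoʳ-≤ (2 * r) (*-monoʳ-≤ 2 t≤r)) ⟩
    2 * t * (2 * r + 2 * r)  ≡⟨ collect t r ⟩
    8 * (t * r)              ≤⟨ 8tr≤d ⟩
    d                        ≡⟨ a+e≡d ⟨
    a + e                    ∎
    where
    open ≤-Reasoning
    collect : ∀ t r → 2 * t * (2 * r + 2 * r) ≡ 8 * (t * r)
    collect = solve-∀

  b : ℕ
  b = ball n R

  s : ℕ
  s = n C R + n C suc R

  t*C≤2b : t * (n C R) ≤ 2 * b
  t*C≤2b = t*C≤2*ball R≤n t≤R a+t≡1+R (trans (cong (R +_) a+e≡d) R+d≡n+t) 2te≤a+e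

  s≤4C : s ≤ 4 * (n C R)
  s≤4C = +-monoʳ-≤ (n C R) (C-next≤ 3 (+-cancelˡ-≤ R _ _ (begin
    R + (n ∸ R)              ≡⟨ m+[n∸m]≡n R≤n ⟩
    n                        ≤⟨ n≤1+2R+2r ⟩
    suc (2 * R + 2 * r)      ≤⟨ s≤s (+-monoʳ-≤ (2 * R) (*-monoʳ-≤ 2 r≤R)) ⟩
    suc (2 * R + 2 * R)      ≤⟨ m≤n+m _ 2 ⟩
    2 + suc (2 * R + 2 * R)  ≡⟨ collect R ⟩
    R + 3 * suc R            ∎)))
    where
    open ≤-Reasoning
    collect : ∀ R → 2 + suc (2 * R + 2 * R) ≡ R + 3 * suc R
    collect = solve-∀

  s*t≤8b : s * t ≤ 8 * b
  s*t≤8b = begin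
    s * t              ≤⟨ *-monoˡ-≤ t s≤4C ⟩
    4 * (n C R) * t    ≡⟨ regroup 4 (n C R) t ⟩
    4 * (t * (n C R))  ≤⟨ *-monoʳ-≤ 4 t*C≤2b ⟩
    4 * (2 * b)        ≡⟨ *-assoc 4 2 b ⟨
    8 * b              ∎
    where
    open ≤-Reasoning
    regroup : ∀ x y z → x * y * z ≡ x * (z * y)
    regroup = solve-∀

  n≤57600Lt² : n ≤ 57600 * L * (t * t)
  n≤57600Lt² = *-cancelʳ-≤′ n 0<n (begin
    n * n                          ≤⟨ *-mono-≤ n≤40tr n≤40tr ⟩
    40 * (t * r) * (40 * (t * r))  ≡⟨ square t r ⟩
    1600 * (t * t) * (r * r)       ≤⟨ *-monoʳ-≤ (1600 * (t * t)) r²≤12M ⟩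
    1600 * (t * t) * (12 * M)      ≡⟨ regroup t n (L + 2) ⟩
    19200 * (L + 2) * (t * t) * n  ≤⟨ *-monoˡ-≤ n (*-monoˡ-≤ (t * t) (*-monoʳ-≤ 19200 L+2≤3L)) ⟩
    19200 * (3 * L) * (t * t) * n  ≡⟨ cong (λ m → m * (t * t) * n) (*-assoc 19200 3 L) ⟨
    57600 * L * (t * t) * n        ∎)
    where
    open ≤-Reasoning
    n≤40tr : n ≤ 40 * (t * r)
    n≤40tr = ≤-trans (<⇒≤ n<[1+t]*20r) (≤-trans (*-monoˡ-≤ (20 * r) (+-monoˡ-≤ t 0<t)) (≤-reflexive (double t r)))
      where
      double : ∀ t r → (t + t) * (20 * r) ≡ 40 * (t * r)
      double = solve-∀
    L+2≤3L : L + 2 ≤ 3 * L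
    L+2≤3L = ≤-trans (+-monoʳ-≤ L (+-mono-≤ 1≤L 1≤L)) (≤-reflexive (triple L))
      where
      1≤L : 1 ≤ L
      1≤L = ≤-trans z<s 20≤L
      triple : ∀ L → L + (L + L) ≡ 3 * L
      triple = solve-∀
    square : ∀ t r → 40 * (t * r) * (40 * (t * r)) ≡ 1600 * (t * t) * (r * r)
    square = solve-∀
    regroup : ∀ t n K → 1600 * (t * t) * (12 * (n * K)) ≡ 19200 * K * (t * t) * n
    regroup = solve-∀

  s²n≤3686400b²L : s * s * n ≤ 3686400 * (b * b) * L
  s²n≤3686400b²L = begin
    s * s * n                      ≤⟨ *-monoʳ-≤ (s * s) n≤57600Lt² ⟩
    s * s * (57600 * L * (t * t))  ≡⟨ regroup s t L ⟩
    57600 * L * (s * t * (s * t))  ≤⟨ *-monoʳ-≤ (57600 * L) (*-mono-≤ s*t≤8b s*t≤8b) ⟩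
    57600 * L * (8 * b * (8 * b))  ≡⟨ collect 57600 L b ⟩
    3686400 * (b * b) * L          ∎
    where
    open ≤-Reasoning
    regroup : ∀ s t L → s * s * (57600 * L * (t * t)) ≡ 57600 * L * (s * t * (s * t))
    regroup = solve-∀
    -- The ring solver cannot cope with the literal 3686400, so the constant is abstracted.
    collect : ∀ c L b → c * L * (8 * b * (8 * b)) ≡ c * 64 * (b * b) * L
    collect = solve-∀

  u : ℕ
  u = ⌊ r /2⌋

  N : ℕ
  N = R + u

  0<N : 0 < N
  0<N = ≤-trans 0<R (m≤m+n R u)

  N≤n : N ≤ n
  N≤n = ≤-trans (+-monoʳ-≤ R (⌊n/2⌋≤n r)) (≤-trans (≤-reflexive R+r≡h) (⌊n/2⌋≤n n))

  D : ℕ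
  D = suc (n ∸ N)

  N+D≡1+n : N + D ≡ suc n
  N+D≡1+n = trans (+-suc N (n ∸ N)) (cong suc (m+[n∸m]≡n N≤n))

  N+r≤D : N + r ≤ D
  N+r≤D = +-cancelˡ-≤ N _ _ (begin
    N + (N + r)          ≡⟨ expand R u r ⟩
    2 * R + (2 * u + r)  ≤⟨ +-monoʳ-≤ (2 * R) (+-monoˡ-≤ r (proj₁ (⌊n/2⌋-bounds r))) ⟩
    2 * R + (r + r)      ≡⟨ cong (2 * R +_) (cong (r +_) (+-identityʳ r)) ⟨
    2 * R + 2 * r        ≤⟨ 2R+2r≤n ⟩
    n                    ≤⟨ n≤1+n n ⟩
    suc n                ≡⟨ N+D≡1+n ⟨
    N + D                ∎)
    where
    open ≤-Reasoning
    expand : ∀ R u r → R + u + (R + u + r) ≡ 2 * R + (2 * u + r)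
    expand = solve-∀

  w : ℕ
  w = suc (n / r)

  n<w*r : n < w * r
  n<w*r = m<[1+m/n]*n n r

  w*r≤n+r : w * r ≤ n + r
  w*r≤n+r = ≤-trans (+-monoʳ-≤ r (m/n*n≤m n r)) (≤-reflexive (+-comm r n))

  [L+2]w<r : (L + 2) * w < r
  [L+2]w<r = *-cancelʳ-< r _ _ (begin-strict
    (L + 2) * w * r                ≡⟨ *-assoc (L + 2) w r ⟩
    (L + 2) * (w * r)              ≤⟨ *-monoʳ-≤ (L + 2) w*r≤n+r ⟩
    (L + 2) * (n + r)              ≤⟨ m≤m+n _ r ⟩
    (L + 2) * (n + r) + r          ≡⟨ split L n r ⟩
    (L + 2) * n + (L + 3) * r      ≤⟨ +-monoʳ-≤ ((L + 2) * n) (*-mono-≤ L+3≤2[L+2] r≤n) ⟩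
    (L + 2) * n + 2 * (L + 2) * n  ≡⟨ collect L n ⟩
    3 * M                          <⟨ 3M<[1+q]² ⟩
    r * r                          ∎)
    where
    open ≤-Reasoning
    r≤n : r ≤ n
    r≤n = ≤-trans (m≤n*m r 20) 20r≤n
    L+3≤2[L+2] : L + 3 ≤ 2 * (L + 2)
    L+3≤2[L+2] = ≤-trans (m≤m+n (L + 3) (L + 1)) (≤-reflexive (double L))
      where
      double : ∀ L → L + 3 + (L + 1) ≡ 2 * (L + 2)
      double = solve-∀
    split : ∀ L n r → (L + 2) * (n + r) + r ≡ (L + 2) * n + (L + 3) * r
    split = solve-∀
    collect : ∀ L n → (L + 2) * n + 2 * (L + 2) * n ≡ 3 * (n * (L + 2))
    collect = solve-∀

  j : ℕ
  j = suc ⌊ L /2⌋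

  j*w≤u : j * w ≤ u
  j*w≤u = *-cancelˡ-≤ 2 (≤-pred (begin-strict
    2 * (j * w)            ≡⟨ expand ⌊ L /2⌋ w ⟩
    (2 * ⌊ L /2⌋ + 2) * w  ≤⟨ *-monoˡ-≤ w (+-monoˡ-≤ 2 (proj₁ (⌊n/2⌋-bounds L))) ⟩
    (L + 2) * w            <⟨ [L+2]w<r ⟩
    r                      ≤⟨ proj₂ (⌊n/2⌋-bounds r) ⟩
    suc (2 * u)            ∎))
    where
    open ≤-Reasoning
    expand : ∀ l w → 2 * ((1 + l) * w) ≡ (2 * l + 2) * w
    expand = solve-∀

  b*2^j≤2^n : b * 2 ^ j ≤ 2 ^ n
  b*2^j≤2^n = ball*2^j≤2^n {n} {R} {u} {D} {r} {w} {j} 0<N N+r≤D (≤-reflexive N+D≡1+n)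
    (≤-trans N≤n (<⇒≤ n<w*r)) (m+[n∸m]≡n (subst (_≤ u) (*-comm j w) j*w≤u))

  n≤2^j*2^j : n ≤ 2 ^ j * 2 ^ j
  n≤2^j*2^j = ≤-trans (<⇒≤ n<2^[1+L]) (≤-trans (^-monoʳ-≤ 2 1+L≤j+j) (≤-reflexive (^-distribˡ-+-* 2 j j)))
    where
    1+L≤j+j : suc L ≤ j + j
    1+L≤j+j = ≤-trans (s≤s (proj₂ (⌊n/2⌋-bounds L))) (≤-reflexive (double ⌊ L /2⌋))
      where
      double : ∀ l → 2 + 2 * l ≡ suc l + suc l
      double = solve-∀

  b²n≤4^nL : b * b * n ≤ 4 ^ n * L
  b²n≤4^nL = begin
    b * b * n                ≤⟨ *-monoʳ-≤ (b * b) n≤2^j*2^j ⟩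
    b * b * (2 ^ j * 2 ^ j)  ≡⟨ interchange b (2 ^ j) ⟩
    b * 2 ^ j * (b * 2 ^ j)  ≤⟨ *-mono-≤ b*2^j≤2^n b*2^j≤2^n ⟩
    2 ^ n * 2 ^ n            ≡⟨ 4^n≡2^n*2^n n ⟨
    4 ^ n                    ≤⟨ m≤m*n (4 ^ n) L {{>-nonZero (≤-trans z<s 20≤L)}} ⟩
    4 ^ n * L                ∎
    where
    open ≤-Reasoning
    interchange : ∀ b x → b * b * (x * x) ≡ b * x * (b * x)
    interchange = solve-∀

k²n≤[2K+2]4^nL : ∀ {k b s n L K} → 0 < b → k * b ≤ s * 2 ^ n + b * b → b * b * n ≤ 4 ^ n * L →
       s * s * n ≤ K * (b * b) * L → k * k * n ≤ (2 * K + 2) * 4 ^ n * L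
k²n≤[2K+2]4^nL {k} {b} {s} {n} {L} {K} 0<b kb≤ b²n≤ s²n≤ = *-cancelʳ-≤′ (b * b) (*-mono-≤ 0<b 0<b) (begin
  k * k * n * (b * b)                                              ≡⟨ regroup k b n ⟩
  k * b * (k * b) * n                                              ≤⟨ *-monoˡ-≤ n (*-mono-≤ kb≤ kb≤) ⟩
  (s * 2ⁿ + b * b) * (s * 2ⁿ + b * b) * n                          ≤⟨ *-monoˡ-≤ n ([x+y]²≤2x²+2y² (s * 2ⁿ) (b * b)) ⟩
  (2 * (s * 2ⁿ * (s * 2ⁿ)) + 2 * (b * b * (b * b))) * n            ≡⟨ expand s b n 2ⁿ ⟩
  2 * (2ⁿ * 2ⁿ) * (s * s * n) + 2 * (b * b) * (b * b * n)          ≤⟨ +-mono-≤ (*-monoʳ-≤ (2 * (2ⁿ * 2ⁿ)) s²n≤) (*-monoʳ-≤ (2 * (b * b)) b²n≤) ⟩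
  2 * (2ⁿ * 2ⁿ) * (K * (b * b) * L) + 2 * (b * b) * (4 ^ n * L)    ≡⟨ cong (λ F → 2 * (2ⁿ * 2ⁿ) * (K * (b * b) * L) + 2 * (b * b) * (F * L)) (4^n≡2^n*2^n n) ⟩
  2 * (2ⁿ * 2ⁿ) * (K * (b * b) * L) + 2 * (b * b) * (2ⁿ * 2ⁿ * L)  ≡⟨ collect (2ⁿ * 2ⁿ) K (b * b) L ⟩
  (2 * K + 2) * (2ⁿ * 2ⁿ) * L * (b * b)                            ≡⟨ cong (λ F → (2 * K + 2) * F * L * (b * b)) (4^n≡2^n*2^n n) ⟨
  (2 * K + 2) * 4 ^ n * L * (b * b)                                ∎)
  where
  open ≤-Reasoning
  2ⁿ : ℕ
  2ⁿ = 2 ^ n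
  regroup : ∀ k b n → k * k * n * (b * b) ≡ k * b * (k * b) * n
  regroup = solve-∀
  expand : ∀ s b n 2ⁿ → (2 * (s * 2ⁿ * (s * 2ⁿ)) + 2 * (b * b * (b * b))) * n ≡
           2 * (2ⁿ * 2ⁿ) * (s * s * n) + 2 * (b * b) * (b * b * n)
  expand = solve-∀
  collect : ∀ F K B L → 2 * F * (K * B * L) + 2 * B * (F * L) ≡ (2 * K + 2) * F * L * B
  collect = solve-∀

integrity-bound-large : ∀ {n k} → 2 ≤ n → IsIntegrity n k → 2 ^ 20 ≤ n →
                        k * k * n ≤ (2 * 3686400 + 2) * 4 ^ n * ⌊log₂ n ⌋
integrity-bound-large {n} {k} 2≤n integrity 2^20≤n =
  k²n≤[2K+2]4^nL {k} {b} {s} {K = 3686400} (0<ball n R) (integrity*ball≤ n R integrity) b²n≤4^nL s²n≤3686400b²L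
  where
  bounds : 2 ^ ⌊log₂ n ⌋ ≤ n × n < 2 * 2 ^ ⌊log₂ n ⌋
  bounds = log₂-bounds n (≤-trans z<s 2≤n)
  20≤L : 20 ≤ ⌊log₂ n ⌋
  20≤L = ≮⇒≥ (λ L<20 → <⇒≱ (<-≤-trans (proj₂ bounds) (^-monoʳ-≤ 2 L<20)) 2^20≤n)
  open RadiusChoice n ⌊log₂ n ⌋ 20≤L (proj₁ bounds) (proj₂ bounds)

integrity-bound-small : ∀ {n k} → 2 ≤ n → IsIntegrity n k → n < 2 ^ 20 →
                        k * k * n ≤ 2 ^ 20 * 4 ^ n * ⌊log₂ n ⌋
integrity-bound-small {n} {k} 2≤n integrity n<2^20 = begin
  k * k * n                   ≤⟨ *-mono-≤ (*-mono-≤ k≤2^n k≤2^n) (<⇒≤ n<2^20) ⟩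
  2 ^ n * 2 ^ n * 2 ^ 20      ≡⟨ cong (_* 2 ^ 20) (4^n≡2^n*2^n n) ⟨
  4 ^ n * 2 ^ 20              ≡⟨ *-comm (4 ^ n) (2 ^ 20) ⟩
  2 ^ 20 * 4 ^ n              ≤⟨ m≤m*n (2 ^ 20 * 4 ^ n) ⌊log₂ n ⌋ {{>-nonZero (⌊log₂⌋-mono-≤ {2} {n} 2≤n)}} ⟩
  2 ^ 20 * 4 ^ n * ⌊log₂ n ⌋  ∎
  where
  open ≤-Reasoning
  k≤2^n : k ≤ 2 ^ n
  k≤2^n = integrity≤2^n integrity

theorem1p4 : ∃[ C ] (0 < C × (∀ n → 2 ≤ n → ∀ k → IsIntegrity n k →
               k * k * n ≤ C * 4 ^ n * ⌊log₂ n ⌋))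
theorem1p4 = 2 ^ 23 , m^n>0 2 23 , λ n 2≤n k integrity →
  -- A `with` on 2 ^ 20 ≤? n instead would normalise the literal 2 ^ 23 in the goal.
  [ (λ large → ≤-trans (integrity-bound-large 2≤n integrity large) (weaken {n = n} (≤ᵇ⇒≤ (2 * 3686400 + 2) (2 ^ 23) _)))
  , (λ small → ≤-trans (integrity-bound-small 2≤n integrity small) (weaken {n = n} (^-monoʳ-≤ 2 (≤ᵇ⇒≤ 20 23 _))))
  ]′ (≤-<-connex (2 ^ 20) n)
  where
  weaken : ∀ {c n} → c ≤ 2 ^ 23 → c * 4 ^ n * ⌊log₂ n ⌋ ≤ 2 ^ 23 * 4 ^ n * ⌊log₂ n ⌋
  weaken {n = n} c≤ = *-monoˡ-≤ ⌊log₂ n ⌋ (*-monoˡ-≤ (4 ^ n) c≤)
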